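{- Let $p$ and $q$ be primes with $p<q<3p$ and $p\equiv q\equiv 3\pmod 4$, and let $d=pq$. Then $K=\mathbb{Q}(\sqrt d)$ has a prime ideal that is PWR.
   Context: $\Lambda:K\to\mathbb{R}^2$, $\Lambda(\alpha)=(\sigma_1(\alpha),\sigma_2(\alpha))$ with $\sigma_{1,2}(x+y\sqrt d)=x\pm y\sqrt d$. A lattice in $\mathbb{R}^2$ is well-rounded (WR) if its nonzero vectors of minimal Euclidean length span $\mathbb{R}^2$; an ideal $I$ of $O_K$ is PWR if it is principal and $\Lambda(I)$ is WR. -}

module Defs where

open import Data.Nat as ℕ using (ℕ)
open import Data.Integer using (ℤ; +_; _+_; _-_; _*_; _≤_)
open import Data.Integer.Divisibility using (_∣_)
open import Data.Product using (_×_; _,_; Σ; ∃)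
open import Data.Sum using (_⊎_)
open import Relation.Binary.PropositionalEquality using (_≡_; _≢_)

-- Throughout, d : ℤ is a squarefree integer with d ≡ 1 (mod 4), K = ℚ(√d).
-- An element of K is represented by "half coordinates" (a , b) : ℤ × ℤ,
-- standing for the number (a + b√d)/2.
Elt : Set
Elt = ℤ × ℤ

-- Membership in O_K = ℤ[(1+√d)/2] = { (a + b√d)/2 : a ≡ b (mod 2) }  (d ≡ 1 mod 4).
InOK : Elt → Set
InOK (a , b) = (+ 2) ∣ (a - b)

-- 4·(αβ) in the basis (1, √d): for α = (a+b√d)/2, β = (c+e√d)/2,
-- αβ = ((ac + d b e) + (a e + b c)√d)/4.
prod4 : ℤ → Elt → Elt → Elt
prod4 d (a , b) (c , e) = (a * c + d * (b * e) , a * e + b * c)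

one : Elt
one = (+ 2 , + 0)

IsZero : Elt → Set
IsZero x = x ≡ (+ 0 , + 0)

InPrincipal : ℤ → Elt → Elt → Set
InPrincipal d γ x = Σ Elt (λ δ → InOK δ × (prod4 d γ δ ≡ prod4 d x one))

IsPrimePrincipal : ℤ → Elt → Set
IsPrimePrincipal d γ =
  (InPrincipal d γ one → Data.Empty.⊥) ×
  (∀ α β → InOK α → InOK β →
     Σ Elt (λ δ → InOK δ × (prod4 d γ δ ≡ prod4 d α β)) →
     InPrincipal d γ α ⊎ InPrincipal d γ β)
  where import Data.Empty

-- Twice the squared Euclidean length of Λ(α) = (σ₁ α, σ₂ α):
-- |Λ((a+b√d)/2)|² = ((a+b√d)² + (a-b√d)²)/4 = (a² + d b²)/2.
sqLen2 : ℤ → Elt → ℤ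
sqLen2 d (a , b) = a * a + d * (b * b)

-- For α = (a+b√d)/2, β = (c+e√d)/2:
-- det [Λ α ; Λ β] = σ₁α σ₂β − σ₂α σ₁β = (b c − a e)√d / 2,
-- so Λα, Λβ are linearly independent in ℝ² iff a e − b c ≠ 0 (d ≠ 0).
Independent : Elt → Elt → Set
Independent (a , b) (c , e) = a * e - b * c ≢ + 0

WellRounded : ℤ → (Elt → Set) → Set
WellRounded d I =
  Σ Elt λ α → Σ Elt λ β →
    I α × I β × (IsZero α → Data.Empty.⊥) × (IsZero β → Data.Empty.⊥) ×
    Independent α β ×
    sqLen2 d α ≡ sqLen2 d β ×
    (∀ δ → I δ → (IsZero δ → Data.Empty.⊥) → sqLen2 d α ≤ sqLen2 d δ)
  where import Data.Empty

HasPrimePWR : ℤ → Set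
HasPrimePWR d =
  Σ Elt λ γ → InOK γ × IsPrimePrincipal d γ × WellRounded d (InPrincipal d γ)

-- Pell's equation x² - d y² = ±1 has a solution with y ≠ 0: the reduced
-- quadratic irrationals (P + √d)/Q are finitely many and one step of the continued
-- fraction expansion permutes them, so the expansion of 1/(√d - ⌊√d⌋) is periodic, and
-- at the end of a period the convergents give a unit.  The sign -1 is impossible, since
-- p ∣ x² + 1 would make p ≡ 3 (mod 4) a sum of two squares (Thue's lemma).
--
-- From x² - d y² = 1 we descend: with g = gcd(x + 1, y), a = (x + 1)/g and b = y/g the
-- norm n = a² - d b² is an odd divisor of 2d, hence of d.  If n = ±1 or n = ±d we get a
-- solution with smaller |y|, so eventually a² - d b² = ±p (or ±q; swap p and q).
--
-- Then p ∣ a, and γ = a + b√d generates the ideal {(x₁ + x₂√d)/2 ∈ O_K : p ∣ x₁} of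
-- norm p, which is prime.  Its lattice contains Λ((p ± √d)/2), two independent vectors
-- of squared length (p² + pq)/2, and these are shortest because p/3 ≤ q ≤ 3p.

module Submission where

open import Defs
open import Data.Nat as ℕ using (ℕ; zero; suc)
import Data.Nat.Properties as ℕₚ
import Data.Nat.Divisibility as ℕᵈ
open import Data.Nat.DivMod using (m≡m%n+[m/n]*n)
open import Data.Nat.GCD using (module GCD; module Bézout)
open import Data.Nat.GeneralisedArithmetic using (fold; fold-+)
open import Data.Nat.Induction using (<-rec)
open import Data.Nat.Primality using (Prime; euclidsLemma; prime⇒irreducible; prime⇒nonZero; ¬prime[0]; ¬prime[1])
import Data.Nat.Tactic.RingSolver as ℕ-Solver
open import Data.Integer hiding (suc)
open import Data.Integer.Properties
open import Data.Integer.Tactic.RingSolver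
open import Data.Integer.DivMod using (n%ℕd<d; a≡a%ℕn+[a/ℕn]*n)
open import Data.Integer.Divisibility.Signed using (_∣_; divides; ∣ᵤ⇒∣; ∣⇒∣ᵤ; ∣-trans)
open import Data.Fin as Fin using (Fin; toℕ; fromℕ<; combine; remQuot)
import Data.Fin.Properties as Finₚ
open import Data.List using (_∷_; [])
open import Data.Product using (Σ; ∃; _×_; _,_; proj₁; proj₂)
open import Data.Sum using (_⊎_; inj₁; inj₂; [_,_]′)
import Data.Sum as Sum
open import Data.Empty using (⊥; ⊥-elim)
open import Function using (id; _∘′_)
open import Relation.Nullary using (¬_; Dec; yes; no)
open import Relation.Nullary.Decidable using (_⊎-dec_; toSum)
open import Relation.Binary.PropositionalEquality

-- Identities and inequalities over ℤ by certificates

infixl 4 _⊕_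
infix 5 _·_

_·_ : (c : ℤ) {x y : ℤ} → x ≡ y → c * (x - y) ≡ 0ℤ
_·_ c {x} refl = trans (cong (c *_) (+-inverseʳ x)) (*-zeroʳ c)

_⊕_ : ∀ {e f} → e ≡ 0ℤ → f ≡ 0ℤ → e + f ≡ 0ℤ
refl ⊕ refl = refl

-- l ≡ r follows from hypotheses hᵢ : xᵢ ≡ yᵢ once the ring solver verifies
-- l ≡ r + Σ cᵢ (xᵢ - yᵢ); the sum is written c₁ · h₁ ⊕ c₂ · h₂ ⊕ ….  Since solve only
-- abstracts over variables, arithmetic lemmas below take integer variables with defining
-- equations (R ≡ + 4 * k + + 3, …) rather than terms such as + p.
by-combination : ∀ {l r e} → e ≡ 0ℤ → l ≡ r + e → l ≡ r
by-combination {r = r} refl l≡r+0 = trans l≡r+0 (+-identityʳ r)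

-- Inequalities are stated as 0ℤ ≤ e (strict ones as 0ℤ ≤ e - 1ℤ) and proved by
-- rewriting e, with the ring solver, as a sum of products of expressions already known
-- to be nonnegative.
by-nonNeg : ∀ {e e′} → 0ℤ ≤ e → e′ ≡ e → 0ℤ ≤ e′
by-nonNeg 0≤e refl = 0≤e

0≤+ : ∀ n → 0ℤ ≤ + n
0≤+ n = +≤+ ℕ.z≤n

0≤-* : ∀ {a b} → 0ℤ ≤ a → 0ℤ ≤ b → 0ℤ ≤ a * b
0≤-* {+ m} {+ n} _ _ = subst (0ℤ ≤_) (pos-* m n) (0≤+ (m ℕ.* n))

¬0≤-1 : ¬ (0ℤ ≤ -1ℤ)
¬0≤-1 ()

0≤-or-<0 : ∀ a → 0ℤ ≤ a ⊎ 0ℤ ≤ - a - 1ℤ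
0≤-or-<0 (+ n) = inj₁ (0≤+ n)
0≤-or-<0 -[1+ n ] = inj₂ (0≤+ n)

0≤-by-contradiction : ∀ e → (0ℤ ≤ - e - 1ℤ → 0ℤ ≤ -1ℤ) → 0ℤ ≤ e
0≤-by-contradiction e absurd = [ id , ⊥-elim ∘′ ¬0≤-1 ∘′ absurd ]′ (0≤-or-<0 e)

0≤-square : ∀ a → 0ℤ ≤ a * a
0≤-square a = [ (λ 0≤a → 0≤-* 0≤a 0≤a) , from-neg ]′ (0≤-or-<0 a)
  where
  from-neg : 0ℤ ≤ - a - 1ℤ → 0ℤ ≤ a * a
  from-neg a<0 = by-nonNeg (0≤-* 0≤-a 0≤-a) (solve (a ∷ []))
    where 0≤-a = +-mono-≤ a<0 (0≤+ 1)

≢0-cases : ∀ a → a ≢ 0ℤ → 0ℤ ≤ a - 1ℤ ⊎ 0ℤ ≤ - a - 1ℤ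
≢0-cases (+ zero) a≢0 = ⊥-elim (a≢0 refl)
≢0-cases +[1+ n ] _ = inj₁ (0≤+ n)
≢0-cases -[1+ n ] _ = inj₂ (0≤+ n)

0≤-square-1 : ∀ a → a ≢ 0ℤ → 0ℤ ≤ a * a - 1ℤ
0≤-square-1 a a≢0 = [ from-pos , from-neg ]′ (≢0-cases a a≢0)
  where
  from-pos : 0ℤ ≤ a - 1ℤ → 0ℤ ≤ a * a - 1ℤ
  from-pos h = by-nonNeg (+-mono-≤ (0≤-* h h) (0≤-* (0≤+ 2) h)) (solve (a ∷ []))
  from-neg : 0ℤ ≤ - a - 1ℤ → 0ℤ ≤ a * a - 1ℤ
  from-neg h = by-nonNeg (+-mono-≤ (0≤-* h h) (0≤-* (0≤+ 2) h)) (solve (a ∷ []))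

0≤-antisym : ∀ {e} → 0ℤ ≤ e → 0ℤ ≤ - e → e ≡ 0ℤ
0≤-antisym {+ zero} _ _ = refl
0≤-antisym {+[1+ n ]} _ ()

*-cancelˡ-pos : ∀ {q} x y → 0ℤ ≤ q - 1ℤ → q * x ≡ q * y → x ≡ y
*-cancelˡ-pos {+[1+ n ]} x y _ = *-cancelˡ-≡ +[1+ n ] x y

1≤-factor : ∀ q x → 0ℤ ≤ q - 1ℤ → 0ℤ ≤ q * x - 1ℤ → 0ℤ ≤ x - 1ℤ
1≤-factor q x 1≤q 1≤qx = 0≤-by-contradiction (x - 1ℤ) x≤0⇒absurd
  where
  x≤0⇒absurd : 0ℤ ≤ - (x - 1ℤ) - 1ℤ → 0ℤ ≤ -1ℤ
  x≤0⇒absurd x≤0 = by-nonNeg (+-mono-≤ 1≤qx (+-mono-≤ (0≤-* 1≤q x≤0) x≤0)) (solve (q ∷ x ∷ []))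

infix 4 _≡±_

_≡±_ : ℤ → ℤ → Set
x ≡± c = x ≡ c ⊎ x ≡ - c

≡±-neg : ∀ {x} → x ≡± 1ℤ → - x ≡± 1ℤ
≡±-neg (inj₁ refl) = inj₂ refl
≡±-neg (inj₂ refl) = inj₁ refl

parity : ∀ z → Σ ℤ λ k → z ≡ + 2 * k ⊎ z ≡ + 2 * k + 1ℤ
parity z = from-remainder (z /ℕ 2) (n%ℕd<d z 2) (a≡a%ℕn+[a/ℕn]*n z 2)
  where
  from-remainder : ∀ {r} k → r ℕ.< 2 → z ≡ + r + k * + 2 → Σ ℤ λ k → z ≡ + 2 * k ⊎ z ≡ + 2 * k + 1ℤ
  from-remainder {0} k _ z≡ = k , inj₁ (trans z≡ (solve (k ∷ [])))
  from-remainder {1} k _ z≡ = k , inj₂ (trans z≡ (solve (k ∷ [])))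
  from-remainder {suc (suc _)} _ (ℕ.s≤s (ℕ.s≤s ())) _

even≢odd : ∀ k j → + 2 * k ≢ + 2 * j + 1ℤ
even≢odd k j 2k≡2j+1 = [ k>j , k≤j ]′ (0≤-or-<0 (k - j - 1ℤ))
  where
  k>j : ¬ (0ℤ ≤ k - j - 1ℤ)
  k>j h = ¬0≤-1 (by-nonNeg (0≤-* (0≤+ 2) h) (by-combination (-1ℤ · 2k≡2j+1) (solve (k ∷ j ∷ []))))
  k≤j : ¬ (0ℤ ≤ - (k - j - 1ℤ) - 1ℤ)
  k≤j h = ¬0≤-1 (by-nonNeg (0≤-* (0≤+ 2) h) (by-combination (1ℤ · 2k≡2j+1) (solve (k ∷ j ∷ []))))

-- Primes, divisors and squares

euclid : ∀ {p} m n → Prime p → + p ∣ m * n → (+ p ∣ m) ⊎ (+ p ∣ n)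
euclid {p} m n p-prime p∣mn =
  Sum.map ∣ᵤ⇒∣ ∣ᵤ⇒∣ (euclidsLemma ∣ m ∣ ∣ n ∣ p-prime (subst (p ℕᵈ.∣_) (abs-* m n) (∣⇒∣ᵤ p∣mn)))

prime∣square⇒∣ : ∀ {p} m → Prime p → + p ∣ m * m → + p ∣ m
prime∣square⇒∣ m p-prime p∣m² = Sum.reduce (euclid m m p-prime p∣m²)

abs≡⇒≡± : ∀ i {n} → ∣ i ∣ ≡ n → i ≡± + n
abs≡⇒≡± (+ m) refl = inj₁ refl
abs≡⇒≡± -[1+ m ] refl = inj₂ refl

divisors-of-prime-product : ∀ {p q m} → Prime p → Prime q → m ℕᵈ.∣ p ℕ.* q →
  m ≡ 1 ⊎ m ≡ p ⊎ m ≡ q ⊎ m ≡ p ℕ.* q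
divisors-of-prime-product {p} {q} {m} p-prime q-prime (ℕᵈ.divides k pq≡km) =
  [ p∣k , p∣m ]′ (euclidsLemma k m p-prime (ℕᵈ.divides q (trans (sym pq≡km) (ℕₚ.*-comm p q))))
  where
  instance _ = prime⇒nonZero p-prime
  p∣k : p ℕᵈ.∣ k → m ≡ 1 ⊎ m ≡ p ⊎ m ≡ q ⊎ m ≡ p ℕ.* q
  p∣k (ℕᵈ.divides k′ refl) = Sum.map₂ (inj₂ ∘′ inj₁) (prime⇒irreducible q-prime (ℕᵈ.divides k′ q≡k′m))
    where
    q≡k′m : q ≡ k′ ℕ.* m
    q≡k′m = ℕₚ.*-cancelˡ-≡ q (k′ ℕ.* m) p (trans pq≡km (ℕ-Solver.solve (k′ ∷ p ∷ m ∷ [])))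
  p∣m : p ℕᵈ.∣ m → m ≡ 1 ⊎ m ≡ p ⊎ m ≡ q ⊎ m ≡ p ℕ.* q
  p∣m (ℕᵈ.divides m′ refl) =
    inj₂ ([ (λ m′≡1 → inj₁ (trans (cong (ℕ._* p) m′≡1) (ℕₚ.*-identityˡ p)))
          , (λ m′≡q → inj₂ (inj₂ (trans (cong (ℕ._* p) m′≡q) (ℕₚ.*-comm q p)))) ]′
      (prime⇒irreducible q-prime (ℕᵈ.divides k q≡km′)))
    where
    q≡km′ : q ≡ k ℕ.* m′
    q≡km′ = ℕₚ.*-cancelʳ-≡ q (k ℕ.* m′) p (trans (ℕₚ.*-comm q p) (trans pq≡km (sym (ℕₚ.*-assoc k m′ p))))

divisors-of-pq : ∀ {p q n} → Prime p → Prime q → n ∣ + p * + q →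
  n ≡± 1ℤ ⊎ n ≡± + p ⊎ n ≡± + q ⊎ n ≡± + p * + q
divisors-of-pq {p} {q} {n} p-prime q-prime n∣pq
  with divisors-of-prime-product p-prime q-prime (subst (∣ n ∣ ℕᵈ.∣_) (abs-* (+ p) (+ q)) (∣⇒∣ᵤ n∣pq))
... | inj₁ ∣n∣≡1 = inj₁ (abs≡⇒≡± n ∣n∣≡1)
... | inj₂ (inj₁ ∣n∣≡p) = inj₂ (inj₁ (abs≡⇒≡± n ∣n∣≡p))
... | inj₂ (inj₂ (inj₁ ∣n∣≡q)) = inj₂ (inj₂ (inj₁ (abs≡⇒≡± n ∣n∣≡q)))
... | inj₂ (inj₂ (inj₂ ∣n∣≡pq)) = inj₂ (inj₂ (inj₂ (subst (n ≡±_) (pos-* p q) (abs≡⇒≡± n ∣n∣≡pq))))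

pq∣square⇒pq∣ : ∀ {p q} a → Prime p → Prime q → p ≢ q → + p * + q ∣ a * a → + p * + q ∣ a
pq∣square⇒pq∣ {p} {q} a p-prime q-prime p≢q pq∣a² =
  from-p∣a (prime∣square⇒∣ a p-prime (∣-trans (divides (+ q) (*-comm (+ p) (+ q))) pq∣a²))
  where
  q∤p : ¬ (+ q ∣ + p)
  q∤p q∣p = [ (λ q≡1 → ¬prime[1] (subst Prime q≡1 q-prime)) , (λ q≡p → p≢q (sym q≡p)) ]′
              (prime⇒irreducible p-prime (∣⇒∣ᵤ q∣p))
  from-p∣a : + p ∣ a → + p * + q ∣ a
  from-p∣a (divides a₁ refl) =
    [ from-q∣a₁ , ⊥-elim ∘′ q∤p ]′ (euclid a₁ (+ p) q-prime (prime∣square⇒∣ (a₁ * + p) q-prime (∣-trans (divides (+ p) refl) pq∣a²)))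
    where
    from-q∣a₁ : + q ∣ a₁ → + p * + q ∣ a₁ * + p
    from-q∣a₁ (divides a₂ refl) = divides a₂ (trans (*-assoc a₂ (+ q) (+ p)) (cong (a₂ *_) (*-comm (+ q) (+ p))))

isqrt : ∀ n → Σ ℕ λ t → t ℕ.* t ℕ.≤ n × n ℕ.< suc t ℕ.* suc t
isqrt zero = 0 , ℕ.z≤n , ℕ.s≤s ℕ.z≤n
isqrt (suc n) with isqrt n
... | t , t²≤n , n<[t+1]² with suc n ℕ.<? suc t ℕ.* suc t
...   | yes n+1<[t+1]² = t , ℕₚ.m≤n⇒m≤1+n t²≤n , n+1<[t+1]²
...   | no n+1≮[t+1]² = suc t , ℕₚ.≤-reflexive (sym n+1≡[t+1]²) ,
          subst (ℕ._< suc (suc t) ℕ.* suc (suc t)) (sym n+1≡[t+1]²) (ℕₚ.*-mono-< (ℕₚ.n<1+n (suc t)) (ℕₚ.n<1+n (suc t)))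
  where
  n+1≡[t+1]² : suc n ≡ suc t ℕ.* suc t
  n+1≡[t+1]² = ℕₚ.≤-antisym n<[t+1]² (ℕₚ.≮⇒≥ n+1≮[t+1]²)

prime≢square : ∀ {p} → Prime p → ∀ t → t ℕ.* t ≢ p
prime≢square {p} p-prime t t²≡p = [ t≢1 , t≢p ]′ (prime⇒irreducible p-prime (ℕᵈ.divides t (sym t²≡p)))
  where
  t≢1 : t ≢ 1
  t≢1 refl = ¬prime[1] (subst Prime (sym t²≡p) p-prime)
  t≢p : t ≢ p
  t≢p refl = ¬prime[1] (subst Prime (ℕₚ.*-cancelʳ-≡ t 1 t (trans t²≡p (sym (ℕₚ.*-identityˡ t)))) p-prime)
    where instance _ = prime⇒nonZero p-prime

prime-product≢square : ∀ {p q} → Prime p → Prime q → p ≢ q → ∀ t → t ℕ.* t ≢ p ℕ.* q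
prime-product≢square {p} {q} p-prime q-prime p≢q t t²≡pq =
  p∤t (Sum.reduce (euclidsLemma t t p-prime (ℕᵈ.divides q (trans t²≡pq (ℕₚ.*-comm p q)))))
  where
  instance _ = prime⇒nonZero p-prime
  p∤t : p ℕᵈ.∣ t → ⊥
  p∤t (ℕᵈ.divides k refl) =
    [ (λ p≡1 → ¬prime[1] (subst Prime p≡1 p-prime)) , p≢q ]′ (prime⇒irreducible q-prime (ℕᵈ.divides (k ℕ.* k) q≡k²p))
    where
    q≡k²p : q ≡ k ℕ.* k ℕ.* p
    q≡k²p = ℕₚ.*-cancelˡ-≡ q (k ℕ.* k ℕ.* p) p (trans (sym t²≡pq) (ℕ-Solver.solve (k ∷ p ∷ [])))

0≤-of-ℕ≤ : ∀ {m n} → m ℕ.≤ n → 0ℤ ≤ + n - + m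
0≤-of-ℕ≤ m≤n = i≤j⇒0≤j-i (+≤+ m≤n)

0≤-of-ℕ< : ∀ {m n} → m ℕ.< n → 0ℤ ≤ + n - + m - 1ℤ
0≤-of-ℕ< {m} {n} m<n = by-nonNeg (0≤-of-ℕ≤ m<n) (trans (shift (+ n) (+ m)) (cong (λ k → + n - k) (sym (pos-+ 1 m))))
  where
  shift : ∀ a b → a - b - 1ℤ ≡ a - (+ 1 + b)
  shift a b = solve (a ∷ b ∷ [])

≡4k+3 : ∀ r → r ℕ.% 4 ≡ 3 → + r ≡ + 4 * + (r ℕ./ 4) + + 3
≡4k+3 r r%4≡3 = begin
  + r                               ≡⟨ cong +_ (m≡m%n+[m/n]*n r 4) ⟩
  + (r ℕ.% 4 ℕ.+ r ℕ./ 4 ℕ.* 4)     ≡⟨ cong (λ m → + (m ℕ.+ r ℕ./ 4 ℕ.* 4)) r%4≡3 ⟩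
  + (3 ℕ.+ r ℕ./ 4 ℕ.* 4)           ≡⟨ pos-+ 3 (r ℕ./ 4 ℕ.* 4) ⟩
  + 3 + + (r ℕ./ 4 ℕ.* 4)           ≡⟨ cong (λ k → + 3 + k) (pos-* (r ℕ./ 4) 4) ⟩
  + 3 + + (r ℕ./ 4) * + 4           ≡⟨ reorder (+ (r ℕ./ 4)) ⟩
  + 4 * + (r ℕ./ 4) + + 3           ∎
  where
  open ≡-Reasoning
  reorder : ∀ k → + 3 + k * + 4 ≡ + 4 * k + + 3
  reorder k = solve (k ∷ [])

-- Thue's lemma: -1 is not a square modulo a prime p ≡ 3 (mod 4)

square-of-difference-bound : ∀ T a b → 0ℤ ≤ a → 0ℤ ≤ T - a → 0ℤ ≤ b → 0ℤ ≤ T - b →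
  0ℤ ≤ T * T - (a - b) * (a - b)
square-of-difference-bound T a b 0≤a a≤T 0≤b b≤T =
  by-nonNeg (0≤-* (+-mono-≤ a≤T 0≤b) (+-mono-≤ b≤T 0≤a)) (solve (T ∷ a ∷ b ∷ []))

nonzero⇒1≤sum-of-squares : ∀ U V → ¬ (U ≡ 0ℤ × V ≡ 0ℤ) → 0ℤ ≤ U * U + V * V - 1ℤ
nonzero⇒1≤sum-of-squares U V nonzero = [ U≡0⇒goal , U≢0⇒goal ]′ (toSum (U ≟ 0ℤ))
  where
  U≢0⇒goal : U ≢ 0ℤ → 0ℤ ≤ U * U + V * V - 1ℤ
  U≢0⇒goal U≢0 = by-nonNeg (+-mono-≤ (0≤-square-1 U U≢0) (0≤-square V)) (solve (U ∷ V ∷ []))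
  U≡0⇒goal : U ≡ 0ℤ → 0ℤ ≤ U * U + V * V - 1ℤ
  U≡0⇒goal U≡0 = by-nonNeg (+-mono-≤ (0≤-square U) (0≤-square-1 V (λ V≡0 → nonzero (U≡0 , V≡0))))
                             (solve (U ∷ V ∷ []))

sole-multiple-below-2P : ∀ {P N c} → N ≡ c * P → 0ℤ ≤ P - 1ℤ → 0ℤ ≤ N - 1ℤ → 0ℤ ≤ + 2 * P - N - 1ℤ → N ≡ P
sole-multiple-below-2P {P} {N} {c} N≡cP 1≤P 1≤N N<2P = by-combination (1ℤ · N≡cP ⊕ P · c-1≡0) (solve (P ∷ N ∷ c ∷ []))
  where
  1≤c : 0ℤ ≤ c - 1ℤ
  1≤c = 1≤-factor P c 1≤P (by-nonNeg 1≤N (by-combination (-1ℤ · N≡cP) (solve (P ∷ N ∷ c ∷ []))))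
  c≤1 : 0ℤ ≤ - (c - 1ℤ)
  c≤1 = by-nonNeg (1≤-factor P (+ 2 - c) 1≤P (by-nonNeg N<2P (by-combination (1ℤ · N≡cP) (solve (P ∷ N ∷ c ∷ [])))))
          (solve (c ∷ []))
  c-1≡0 : c - 1ℤ ≡ 0ℤ
  c-1≡0 = 0≤-antisym 1≤c c≤1

record ThueVector (p t : ℕ) (X : ℤ) : Set where
  field
    U V : ℤ
    nonzero : ¬ (U ≡ 0ℤ × V ≡ 0ℤ)
    U²≤t² : 0ℤ ≤ + t * + t - U * U
    V²≤t² : 0ℤ ≤ + t * + t - V * V
    p∣U-XV : + p ∣ U - X * V

-- The (t + 1)² points (u, v) ∈ [0, t]² outnumber the p residues of u - X v, so two collide.
module _ (p t : ℕ) .{{_ : ℕ.NonZero p}} (X : ℤ) where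
  private
    N = suc t ℕ.* suc t

    cell : Fin N → Fin (suc t) × Fin (suc t)
    cell = remQuot (suc t)

    value : Fin N → ℤ
    value i = + toℕ (proj₁ (cell i)) - X * + toℕ (proj₂ (cell i))

    residue : Fin N → Fin p
    residue i = fromℕ< (n%ℕd<d (value i) p)

    coordinate-bound : ∀ (u : Fin (suc t)) → 0ℤ ≤ + t - + toℕ u
    coordinate-bound u = 0≤-of-ℕ≤ (ℕₚ.≤-pred (Finₚ.toℕ<n u))

    difference-bound : ∀ (u v : Fin (suc t)) → 0ℤ ≤ + t * + t - (+ toℕ u - + toℕ v) * (+ toℕ u - + toℕ v)
    difference-bound u v = square-of-difference-bound (+ t) (+ toℕ u) (+ toℕ v)
      (0≤+ (toℕ u)) (coordinate-bound u) (0≤+ (toℕ v)) (coordinate-bound v)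

    same-residue⇒∣ : ∀ {a b ra rb qa qb P} → a ≡ ra + qa * P → b ≡ rb + qb * P → ra ≡ rb → P ∣ a - b
    same-residue⇒∣ {a} {b} {ra} {rb} {qa} {qb} {P} a≡ b≡ ra≡rb =
      divides (qa - qb) (by-combination (1ℤ · a≡ ⊕ -1ℤ · b≡ ⊕ 1ℤ · ra≡rb)
                                        (solve (a ∷ b ∷ ra ∷ rb ∷ qa ∷ qb ∷ P ∷ [])))

    difference : ∀ a b c e → (a - X * c) - (b - X * e) ≡ (a - b) - X * (c - e)
    difference a b c e = solve (a ∷ b ∷ c ∷ e ∷ X ∷ [])

    from-collision : (∃ λ i → ∃ λ j → i Fin.< j × residue i ≡ residue j) → ThueVector p t X
    from-collision (i , j , i<j , same) = record
      { U = + toℕ u₁ - + toℕ u₂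
      ; V = + toℕ v₁ - + toℕ v₂
      ; nonzero = distinct
      ; U²≤t² = difference-bound u₁ u₂
      ; V²≤t² = difference-bound v₁ v₂
      ; p∣U-XV = subst (+ p ∣_) (difference (+ toℕ u₁) (+ toℕ u₂) (+ toℕ v₁) (+ toℕ v₂))
          (same-residue⇒∣ {qa = value i /ℕ p} {qb = value j /ℕ p}
            (a≡a%ℕn+[a/ℕn]*n (value i) p) (a≡a%ℕn+[a/ℕn]*n (value j) p) (cong +_ same%))
      }
      where
      u₁ = proj₁ (cell i)
      v₁ = proj₂ (cell i)
      u₂ = proj₁ (cell j)
      v₂ = proj₂ (cell j)
      same% : value i %ℕ p ≡ value j %ℕ p
      same% = trans (sym (Finₚ.toℕ-fromℕ< _)) (trans (cong toℕ same) (Finₚ.toℕ-fromℕ< _))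
      coordinate-≡ : ∀ {u v : Fin (suc t)} → + toℕ u - + toℕ v ≡ 0ℤ → u ≡ v
      coordinate-≡ {u} {v} u-v≡0 = Finₚ.toℕ-injective (+-injective (i-j≡0⇒i≡j _ _ u-v≡0))
      distinct : ¬ (+ toℕ u₁ - + toℕ u₂ ≡ 0ℤ × + toℕ v₁ - + toℕ v₂ ≡ 0ℤ)
      distinct (U≡0 , V≡0) = ℕₚ.<-irrefl (cong toℕ i≡j) i<j
        where
        i≡j : i ≡ j
        i≡j = trans (sym (Finₚ.combine-remQuot {suc t} (suc t) i))
                (trans (cong₂ combine (coordinate-≡ {u₁} {u₂} U≡0) (coordinate-≡ {v₁} {v₂} V≡0))
                       (Finₚ.combine-remQuot {suc t} (suc t) j))

  thue-vector : p ℕ.< N → ThueVector p t X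
  thue-vector p<N = from-collision (Finₚ.pigeonhole p<N residue)

short-vector⇒sum-of-squares : ∀ P T X U V → 0ℤ ≤ P - T * T - 1ℤ → 0ℤ ≤ T * T - U * U → 0ℤ ≤ T * T - V * V →
  ¬ (U ≡ 0ℤ × V ≡ 0ℤ) → P ∣ U - X * V → P ∣ X * X + 1ℤ → U * U + V * V ≡ P
short-vector⇒sum-of-squares P T X U V T²<P U²≤T² V²≤T² nonzero (divides c₁ U-XV≡c₁P) (divides c₀ X²+1≡c₀P) =
  sole-multiple-below-2P {P} {U * U + V * V} {c₁ * (U + X * V) + V * V * c₀}
    N≡cP 1≤P (nonzero⇒1≤sum-of-squares U V nonzero) N<2P
  where
  N≡cP : U * U + V * V ≡ (c₁ * (U + X * V) + V * V * c₀) * P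
  N≡cP = by-combination ((U + X * V) · U-XV≡c₁P ⊕ (V * V) · X²+1≡c₀P) (solve (P ∷ X ∷ U ∷ V ∷ c₁ ∷ c₀ ∷ []))
  1≤P : 0ℤ ≤ P - 1ℤ
  1≤P = by-nonNeg (+-mono-≤ T²<P (0≤-square T)) (solve (P ∷ T ∷ []))
  N<2P : 0ℤ ≤ + 2 * P - (U * U + V * V) - 1ℤ
  N<2P = by-nonNeg (+-mono-≤ (+-mono-≤ (+-mono-≤ (0≤-* (0≤+ 2) T²<P) U²≤T²) V²≤T²) (0≤+ 1))
                   (solve (P ∷ T ∷ U ∷ V ∷ []))

prime∣x²+1⇒sum-of-squares : ∀ {p} → Prime p → ∀ X → + p ∣ X * X + 1ℤ →
  Σ ℤ λ U → Σ ℤ λ V → U * U + V * V ≡ + p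
prime∣x²+1⇒sum-of-squares {p} p-prime X p∣X²+1 =
  U , V , short-vector⇒sum-of-squares (+ p) (+ t) X U V t²<p U²≤t² V²≤t² nonzero p∣U-XV p∣X²+1
  where
  instance _ = prime⇒nonZero p-prime
  t = proj₁ (isqrt p)
  t²<p : 0ℤ ≤ + p - + t * + t - 1ℤ
  t²<p = subst (λ s → 0ℤ ≤ + p - s - 1ℤ) (pos-* t t)
           (0≤-of-ℕ< (ℕₚ.≤∧≢⇒< (proj₁ (proj₂ (isqrt p))) (prime≢square p-prime t)))
  open ThueVector (thue-vector p t X (proj₂ (proj₂ (isqrt p))))

square-mod-4 : ∀ U → Σ ℤ λ m → U * U ≡ + 4 * m ⊎ U * U ≡ + 4 * m + 1ℤ
square-mod-4 U = from-parity (parity U)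
  where
  from-parity : (Σ ℤ λ a → U ≡ + 2 * a ⊎ U ≡ + 2 * a + 1ℤ) → Σ ℤ λ m → U * U ≡ + 4 * m ⊎ U * U ≡ + 4 * m + 1ℤ
  from-parity (a , inj₁ refl) = a * a , inj₁ (solve (a ∷ []))
  from-parity (a , inj₂ refl) = a * a + a , inj₂ (solve (a ∷ []))

sum-of-squares≢4k+3 : ∀ U V K → U * U + V * V ≢ + 4 * K + + 3
sum-of-squares≢4k+3 U V K U²+V²≡4K+3 = by-residues (square-mod-4 U) (square-mod-4 V)
  where
  by-residues : (Σ ℤ λ m → U * U ≡ + 4 * m ⊎ U * U ≡ + 4 * m + 1ℤ) →
                (Σ ℤ λ n → V * V ≡ + 4 * n ⊎ V * V ≡ + 4 * n + 1ℤ) → ⊥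
  by-residues (m , inj₁ U²≡4m) (n , inj₁ V²≡4n) = even≢odd (+ 2 * (m + n)) (+ 2 * K + 1ℤ)
    (by-combination (1ℤ · U²+V²≡4K+3 ⊕ -1ℤ · U²≡4m ⊕ -1ℤ · V²≡4n) (solve (U ∷ V ∷ K ∷ m ∷ n ∷ [])))
  by-residues (m , inj₁ U²≡4m) (n , inj₂ V²≡4n+1) = even≢odd (m + n) K (*-cancelˡ-≡ (+ 2) (+ 2 * (m + n)) (+ 2 * K + 1ℤ)
    (by-combination (1ℤ · U²+V²≡4K+3 ⊕ -1ℤ · U²≡4m ⊕ -1ℤ · V²≡4n+1) (solve (U ∷ V ∷ K ∷ m ∷ n ∷ []))))
  by-residues (m , inj₂ U²≡4m+1) (n , inj₁ V²≡4n) = even≢odd (m + n) K (*-cancelˡ-≡ (+ 2) (+ 2 * (m + n)) (+ 2 * K + 1ℤ)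
    (by-combination (1ℤ · U²+V²≡4K+3 ⊕ -1ℤ · U²≡4m+1 ⊕ -1ℤ · V²≡4n) (solve (U ∷ V ∷ K ∷ m ∷ n ∷ []))))
  by-residues (m , inj₂ U²≡4m+1) (n , inj₂ V²≡4n+1) = even≢odd (+ 2 * (m + n) + 1ℤ) (+ 2 * K + 1ℤ)
    (by-combination (1ℤ · U²+V²≡4K+3 ⊕ -1ℤ · U²≡4m+1 ⊕ -1ℤ · V²≡4n+1) (solve (U ∷ V ∷ K ∷ m ∷ n ∷ [])))

-1-nonresidue : ∀ {p} → Prime p → p ℕ.% 4 ≡ 3 → ∀ X → ¬ (+ p ∣ X * X + 1ℤ)
-1-nonresidue {p} p-prime p%4≡3 X p∣X²+1 = not-4k+3 (prime∣x²+1⇒sum-of-squares p-prime X p∣X²+1)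
  where
  not-4k+3 : ¬ (Σ ℤ λ U → Σ ℤ λ V → U * U + V * V ≡ + p)
  not-4k+3 (U , V , U²+V²≡p) = sum-of-squares≢4k+3 U V (+ (p ℕ./ 4)) (trans U²+V²≡p (≡4k+3 p p%4≡3))

-- Pell's equation

fold-preserves : ∀ {A : Set} {f : A → A} (Good : A → Set) → (∀ {x} → Good x → Good (f x)) →
  ∀ {x} → Good x → ∀ n → Good (fold x f n)
fold-preserves Good f-good gx zero = gx
fold-preserves Good f-good gx (suc n) = f-good (fold-preserves Good f-good gx n)

module _ {A : Set} (f : A → A) (Good : A → Set)
  (f-good : ∀ {x} → Good x → Good (f x))
  (f-injective : ∀ {x y} → Good x → Good y → f x ≡ f y → x ≡ y)
  {N : ℕ} (encode : ∀ {x} → Good x → Fin N)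
  (encode-injective : ∀ {x y} (gx : Good x) (gy : Good y) → encode gx ≡ encode gy → x ≡ y) where

  private
    fold-good : ∀ {x} → Good x → ∀ n → Good (fold x f n)
    fold-good = fold-preserves Good f-good

    fold-injective : ∀ n {x y} → Good x → Good y → fold x f n ≡ fold y f n → x ≡ y
    fold-injective zero gx gy eq = eq
    fold-injective (suc n) gx gy eq = fold-injective n gx gy (f-injective (fold-good gx n) (fold-good gy n) eq)

  orbit-returns : ∀ {x} → Good x → Σ ℕ λ m → fold x f (suc m) ≡ x
  orbit-returns {x} gx = from-collision (Finₚ.pigeonhole (ℕₚ.n<1+n N) (λ i → encode (fold-good gx (toℕ i))))
    where
    from-collision : (∃ λ i → ∃ λ j → i Fin.< j × encode (fold-good gx (toℕ i)) ≡ encode (fold-good gx (toℕ j))) →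
                     Σ ℕ λ m → fold x f (suc m) ≡ x
    from-collision (i , j , i<j , same) = m , fold-injective (toℕ i) (fold-good gx (suc m)) gx (begin
      fold (fold x f (suc m)) f (toℕ i) ≡⟨ fold-+ x f (toℕ i) ⟨
      fold x f (toℕ i ℕ.+ suc m)        ≡⟨ cong (fold x f) i+[m+1]≡j ⟩
      fold x f (toℕ j)                  ≡⟨ encode-injective (fold-good gx (toℕ i)) (fold-good gx (toℕ j)) same ⟨
      fold x f (toℕ i)                  ∎)
      where
      open ≡-Reasoning
      m = toℕ j ℕ.∸ suc (toℕ i)
      i+[m+1]≡j : toℕ i ℕ.+ suc m ≡ toℕ j
      i+[m+1]≡j = trans (ℕₚ.+-suc (toℕ i) m) (ℕₚ.m+[n∸m]≡n i<j)

-- ⌊x / y⌋ for y ≥ 1 (the value 0 for y ≤ 0 is never used).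
_div⁺_ : ℤ → ℤ → ℤ
x div⁺ +[1+ n ] = x /ℕ suc n
x div⁺ _ = 0ℤ

div⁺-floor : ∀ x y → 0ℤ ≤ y - 1ℤ → 0ℤ ≤ x - x div⁺ y * y × 0ℤ ≤ x div⁺ y * y + y - x - 1ℤ
div⁺-floor x +[1+ n ] _ = floor-bounds {x} {x /ℕ suc n} {+ (x %ℕ suc n)} {+[1+ n ]}
  (a≡a%ℕn+[a/ℕn]*n x (suc n)) (0≤+ (x %ℕ suc n)) (0≤-of-ℕ< (n%ℕd<d x (suc n)))
  where
  floor-bounds : ∀ {x q r y} → x ≡ r + q * y → 0ℤ ≤ r → 0ℤ ≤ y - r - 1ℤ →
                 0ℤ ≤ x - q * y × 0ℤ ≤ q * y + y - x - 1ℤ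
  floor-bounds {x} {q} {r} {y} x≡r+qy 0≤r r<y =
    by-nonNeg 0≤r (by-combination (1ℤ · x≡r+qy) (solve (x ∷ q ∷ r ∷ y ∷ []))) ,
    by-nonNeg r<y (by-combination (-1ℤ · x≡r+qy) (solve (x ∷ q ∷ r ∷ y ∷ [])))

bounded : ∀ {x} B → 0ℤ ≤ x → 0ℤ ≤ B - x → Fin (suc ∣ B ∣)
bounded {x} B 0≤x x≤B = fromℕ< (ℕ.s≤s (abs-mono 0≤x (0≤i-j⇒j≤i {B} {x} x≤B)))
  where
  abs-mono : ∀ {x B} → 0ℤ ≤ x → x ≤ B → ∣ x ∣ ℕ.≤ ∣ B ∣
  abs-mono (+≤+ _) (+≤+ m≤n) = m≤n

bounded-injective : ∀ {x y} B (0≤x : 0ℤ ≤ x) (0≤y : 0ℤ ≤ y) {x≤B : 0ℤ ≤ B - x} {y≤B : 0ℤ ≤ B - y} →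
  bounded B 0≤x x≤B ≡ bounded B 0≤y y≤B → x ≡ y
bounded-injective B 0≤x 0≤y eq = trans (sym (0≤i⇒+∣i∣≡i 0≤x))
  (trans (cong +_ (trans (sym (Finₚ.toℕ-fromℕ< _)) (trans (cong toℕ eq) (Finₚ.toℕ-fromℕ< _)))) (0≤i⇒+∣i∣≡i 0≤y))

window-unique : ∀ S {P₁ P₂ Q k} → 0ℤ ≤ Q - 1ℤ → P₁ - P₂ ≡ k * Q →
  0ℤ ≤ S - P₁ → 0ℤ ≤ P₁ + Q - S - 1ℤ → 0ℤ ≤ S - P₂ → 0ℤ ≤ P₂ + Q - S - 1ℤ → P₁ ≡ P₂
window-unique S {P₁} {P₂} {Q} {k} 1≤Q P₁-P₂≡kQ P₁≤S S<P₁+Q P₂≤S S<P₂+Q =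
  i-j≡0⇒i≡j P₁ P₂ (trans P₁-P₂≡kQ (trans (cong (_* Q) k≡0) (*-zeroˡ Q)))
  where
  k≤0 : 0ℤ ≤ - k
  k≤0 = by-nonNeg (1≤-factor Q (1ℤ - k) 1≤Q (by-nonNeg (+-mono-≤ S<P₂+Q P₁≤S)
          (by-combination (1ℤ · P₁-P₂≡kQ) (solve (S ∷ P₁ ∷ P₂ ∷ Q ∷ k ∷ []))))) (solve (k ∷ []))
  0≤k : 0ℤ ≤ k
  0≤k = by-nonNeg (1≤-factor Q (1ℤ + k) 1≤Q (by-nonNeg (+-mono-≤ S<P₁+Q P₂≤S)
          (by-combination (-1ℤ · P₁-P₂≡kQ) (solve (S ∷ P₁ ∷ P₂ ∷ Q ∷ k ∷ []))))) (solve (k ∷ []))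
  k≡0 : k ≡ 0ℤ
  k≡0 = 0≤-antisym 0≤k k≤0

NontrivialUnit : ℤ → Set
NontrivialUnit d = Σ ℤ λ x → Σ ℤ λ y → y ≢ 0ℤ × x * x - d * (y * y) ≡± 1ℤ

Alternating : ℤ → ℤ → Set
Alternating m n = Σ ℤ λ σ → 0ℤ ≤ σ * m - 1ℤ × 0ℤ ≤ - (σ * n)

alternating⇒≢0 : ∀ {m n} → Alternating m n → m ≢ 0ℤ
alternating⇒≢0 (σ , σm≥1 , _) refl = ¬0≤-1 (subst (λ e → 0ℤ ≤ e - 1ℤ) (*-zeroʳ σ) σm≥1)

alternating-step : ∀ {m n} a → 0ℤ ≤ a - 1ℤ → Alternating m n → Alternating (n - a * m) m
alternating-step {m} {n} a 1≤a (σ , σm≥1 , σn≤0) =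
  - σ ,
  by-nonNeg (+-mono-≤ (+-mono-≤ (0≤-* 1≤a 0≤σm) σm≥1) σn≤0) (solve (σ ∷ a ∷ m ∷ n ∷ [])) ,
  by-nonNeg 0≤σm (solve (σ ∷ m ∷ []))
  where
  0≤σm : 0ℤ ≤ σ * m
  0≤σm = by-nonNeg (+-mono-≤ σm≥1 (0≤+ 1)) (solve (σ ∷ m ∷ []))

module Pell (S d : ℤ) (1≤S : 0ℤ ≤ S - 1ℤ) (S²<d : 0ℤ ≤ d - S * S - 1ℤ)
            (d<[S+1]² : 0ℤ ≤ (S + 1ℤ) * (S + 1ℤ) - d - 1ℤ) where

  -- state P Q R stands for ξ = (P + √d)/Q with Q R = d - P², and S = ⌊√d⌋.  Reduced
  -- means ξ > 1 and -1 < ξ̄ < 0; step is ξ ↦ 1/(ξ - ⌊ξ⌋), with partial quotient ⌊ξ⌋.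
  record State : Set where
    constructor state
    field P Q R : ℤ

  record IsReduced (P Q R : ℤ) : Set where
    field
      1≤P : 0ℤ ≤ P - 1ℤ
      P≤S : 0ℤ ≤ S - P
      S<P+Q : 0ℤ ≤ P + Q - S - 1ℤ
      Q≤S+P : 0ℤ ≤ S + P - Q
      QR≡d-P² : Q * R ≡ d - P * P

    1≤Q : 0ℤ ≤ Q - 1ℤ
    1≤Q = by-nonNeg (+-mono-≤ S<P+Q P≤S) (solve (S ∷ P ∷ Q ∷ []))

    0≤P : 0ℤ ≤ P
    0≤P = by-nonNeg (+-mono-≤ 1≤P (0≤+ 1)) (solve (P ∷ []))

    0≤Q : 0ℤ ≤ Q
    0≤Q = by-nonNeg (+-mono-≤ 1≤Q (0≤+ 1)) (solve (Q ∷ []))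

    Q≤S+S : 0ℤ ≤ S + S - Q
    Q≤S+S = by-nonNeg (+-mono-≤ Q≤S+P P≤S) (solve (S ∷ P ∷ Q ∷ []))

  Reduced : State → Set
  Reduced (state P Q R) = IsReduced P Q R

  partial-quotient : State → ℤ
  partial-quotient (state P Q R) = (P + S) div⁺ Q

  step : State → State
  step x@(state P Q R) = state (a * Q - P) (R + + 2 * a * P - a * a * Q) Q
    where a = partial-quotient x

  record Successor (P Q P′ Q′ : ℤ) : Set where
    constructor successor
    field
      a : ℤ
      P+P′≡aQ : P + P′ ≡ a * Q
      P′≤S : 0ℤ ≤ S - P′
      S<P′+Q : 0ℤ ≤ P′ + Q - S - 1ℤ
      QQ′≡d-P′² : Q * Q′ ≡ d - P′ * P′

  step-successor : ∀ {P Q R} → IsReduced P Q R → Successor P Q (State.P (step (state P Q R))) (State.Q (step (state P Q R)))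
  step-successor {P} {Q} {R} r = from-floor ((P + S) div⁺ Q) (div⁺-floor (P + S) Q 1≤Q)
    where
    open IsReduced r
    from-floor : ∀ a → 0ℤ ≤ P + S - a * Q × 0ℤ ≤ a * Q + Q - (P + S) - 1ℤ →
                 Successor P Q (a * Q - P) (R + + 2 * a * P - a * a * Q)
    from-floor a (aQ≤P+S , P+S<aQ+Q) = successor a
      (solve (P ∷ Q ∷ a ∷ []))
      (by-nonNeg aQ≤P+S (solve (S ∷ P ∷ Q ∷ a ∷ [])))
      (by-nonNeg P+S<aQ+Q (solve (S ∷ P ∷ Q ∷ a ∷ [])))
      (by-combination (1ℤ · QR≡d-P²) (solve (d ∷ P ∷ Q ∷ R ∷ a ∷ [])))

  partial-quotient-positive : ∀ {P Q R P′ Q′} → IsReduced P Q R → (s : Successor P Q P′ Q′) → 0ℤ ≤ Successor.a s - 1ℤ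
  partial-quotient-positive {P} {Q} {R} {P′} r (successor a P+P′≡aQ _ S<P′+Q _) =
    1≤-factor Q a 1≤Q (by-nonNeg (+-mono-≤ S<P′+Q Q≤S+P)
      (by-combination (-1ℤ · P+P′≡aQ) (solve (S ∷ P ∷ Q ∷ P′ ∷ a ∷ []))))
    where open IsReduced r

  reduced-successor : ∀ {P Q R P′ Q′} → IsReduced P Q R → Successor P Q P′ Q′ → IsReduced P′ Q′ Q
  reduced-successor {P} {Q} {R} {P′} {Q′} r s@(successor a P+P′≡aQ P′≤S S<P′+Q QQ′≡d-P′²) = record
    { 1≤P = 1≤P′
    ; P≤S = P′≤S
    ; S<P+Q = 1≤-factor Q (P′ + Q′ - S) 1≤Q (by-nonNeg (+-mono-≤ S²<d (0≤-* P′≤S Q≤S+P′))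
                (by-combination (1ℤ · QQ′≡d-P′²) (solve (S ∷ d ∷ Q ∷ P′ ∷ Q′ ∷ []))))
    ; Q≤S+P = 0≤-by-contradiction (S + P′ - Q′) Q′>S+P′⇒absurd
    ; QR≡d-P² = trans (*-comm Q′ Q) QQ′≡d-P′²
    }
    where
    open IsReduced r
    1≤a : 0ℤ ≤ a - 1ℤ
    1≤a = partial-quotient-positive r s
    Q≤S+P′ : 0ℤ ≤ S + P′ - Q
    Q≤S+P′ = by-nonNeg (+-mono-≤ (0≤-* 1≤a 0≤Q) P≤S)
      (by-combination (1ℤ · P+P′≡aQ) (solve (S ∷ P ∷ Q ∷ P′ ∷ a ∷ [])))
    Q≤S⇒1≤P′ : 0ℤ ≤ S - Q → 0ℤ ≤ P′ - 1ℤ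
    Q≤S⇒1≤P′ Q≤S = by-nonNeg (+-mono-≤ S<P′+Q Q≤S) (solve (S ∷ Q ∷ P′ ∷ []))
    S<Q⇒1≤P′ : 0ℤ ≤ - (S - Q) - 1ℤ → 0ℤ ≤ P′ - 1ℤ
    S<Q⇒1≤P′ S<Q = by-nonNeg (+-mono-≤ (+-mono-≤ (0≤-* 1≤a 0≤Q) S<Q) P≤S)
      (by-combination (1ℤ · P+P′≡aQ) (solve (S ∷ P ∷ Q ∷ P′ ∷ a ∷ [])))
    1≤P′ : 0ℤ ≤ P′ - 1ℤ
    1≤P′ = [ Q≤S⇒1≤P′ , S<Q⇒1≤P′ ]′ (0≤-or-<0 (S - Q))
    Q′>S+P′⇒absurd : 0ℤ ≤ - (S + P′ - Q′) - 1ℤ → 0ℤ ≤ -1ℤ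
    Q′>S+P′⇒absurd Q′>S+P′ = by-nonNeg
      (+-mono-≤ (+-mono-≤ (0≤-* 0≤Q Q′>S+P′) (0≤-* S<P′+Q (+-mono-≤ (+-mono-≤ 1≤S 1≤P′) (0≤+ 3)))) d<[S+1]²)
      (by-combination (-1ℤ · QQ′≡d-P′²) (solve (S ∷ d ∷ Q ∷ P′ ∷ Q′ ∷ [])))

  step-reduced : ∀ {x} → Reduced x → Reduced (step x)
  step-reduced {state P Q R} r = reduced-successor r (step-successor r)

  reduced-≡ : ∀ {P₁ Q₁ R₁ P₂ Q₂ R₂} → IsReduced P₁ Q₁ R₁ → IsReduced P₂ Q₂ R₂ →
    P₁ ≡ P₂ → Q₁ ≡ Q₂ → state P₁ Q₁ R₁ ≡ state P₂ Q₂ R₂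
  reduced-≡ {P} {Q} {R₁} {_} {_} {R₂} r₁ r₂ refl refl =
    cong (state P Q) (*-cancelˡ-pos {Q} R₁ R₂ (IsReduced.1≤Q r₁)
      (trans (IsReduced.QR≡d-P² r₁) (sym (IsReduced.QR≡d-P² r₂))))

  step-injective : ∀ {x y} → Reduced x → Reduced y → step x ≡ step y → x ≡ y
  step-injective {state P₁ Q₁ R₁} {state P₂ Q₂ R₂} r₁ r₂ eq =
    same-successor {(P₁ + S) div⁺ Q₁} {(P₂ + S) div⁺ Q₂} (cong State.R eq) (cong State.P eq)
    where
    same-successor : ∀ {a₁ a₂} → Q₁ ≡ Q₂ → a₁ * Q₁ - P₁ ≡ a₂ * Q₂ - P₂ →
                     state P₁ Q₁ R₁ ≡ state P₂ Q₂ R₂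
    same-successor {a₁} {a₂} refl P′₁≡P′₂ = reduced-≡ r₁ r₂
      (window-unique S {P₁} {P₂} {Q₁} {a₁ - a₂} (IsReduced.1≤Q r₁)
      (by-combination (-1ℤ · P′₁≡P′₂) (solve (P₁ ∷ P₂ ∷ Q₁ ∷ a₁ ∷ a₂ ∷ [])))
      (IsReduced.P≤S r₁) (IsReduced.S<P+Q r₁) (IsReduced.P≤S r₂) (IsReduced.S<P+Q r₂)) refl

  CodeSize : ℕ
  CodeSize = suc ∣ S ∣ ℕ.* suc ∣ S + S ∣

  code : ∀ {x} → Reduced x → Fin CodeSize
  code {state P Q R} r = combine (bounded S 0≤P P≤S) (bounded (S + S) 0≤Q Q≤S+S)
    where open IsReduced r

  code-injective : ∀ {x y} (rx : Reduced x) (ry : Reduced y) → code rx ≡ code ry → x ≡ y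
  code-injective {state P₁ Q₁ R₁} {state P₂ Q₂ R₂} r₁ r₂ eq = reduced-≡ r₁ r₂
    (bounded-injective S (0≤P r₁) (0≤P r₂) {P≤S r₁} {P≤S r₂} (proj₁ same-codes))
    (bounded-injective (S + S) (0≤Q r₁) (0≤Q r₂) {Q≤S+S r₁} {Q≤S+S r₂} (proj₂ same-codes))
    where
    open IsReduced
    same-codes = Finₚ.combine-injective (bounded S (0≤P r₁) (P≤S r₁)) (bounded (S + S) (0≤Q r₁) (Q≤S+S r₁))
                                        (bounded S (0≤P r₂) (P≤S r₂)) (bounded (S + S) (0≤Q r₂) (Q≤S+S r₂)) eq

  record Convergents : Set where
    constructor convergents
    field m₁ m₂ n₁ n₂ : ℤ

  advance : State × Convergents → State × Convergents
  advance (x , convergents m₁ m₂ n₁ n₂) = step x , convergents (n₁ - a * m₁) (n₂ - a * m₂) m₁ m₂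
    where a = partial-quotient x

  -- n₁ + n₂√d = ξ (m₁ + m₂√d) for ξ = (P + √d)/Q.  Once ξ is back at its initial value
  -- (S + √d)/(d - S²) = 1/(√d - S), this makes n₁ + n₂√d a unit.
  record Tracks (P Q m₁ m₂ n₁ n₂ : ℤ) : Set where
    field
      first : Q * n₁ ≡ P * m₁ + d * m₂
      second : Q * n₂ ≡ m₁ + P * m₂
      unimodular : m₁ * n₂ - m₂ * n₁ ≡± 1ℤ
      alternating : Alternating m₂ n₂

  tracks-successor : ∀ {P Q R P′ Q′ m₁ m₂ n₁ n₂} → IsReduced P Q R → (s : Successor P Q P′ Q′) →
    Tracks P Q m₁ m₂ n₁ n₂ → let a = Successor.a s in Tracks P′ Q′ (n₁ - a * m₁) (n₂ - a * m₂) m₁ m₂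
  tracks-successor {P} {Q} {R} {P′} {Q′} {m₁} {m₂} {n₁} {n₂} r s@(successor a P+P′≡aQ _ _ QQ′≡d-P′²) t = record
    { first = *-cancelˡ-pos {Q} (Q′ * m₁) (P′ * (n₁ - a * m₁) + d * (n₂ - a * m₂)) 1≤Q
        (by-combination (m₁ · QQ′≡d-P′² ⊕ (- P′) · first ⊕ (- d) · second ⊕ (- (m₁ * P′ + d * m₂)) · P+P′≡aQ)
          (solve (d ∷ P ∷ Q ∷ P′ ∷ Q′ ∷ a ∷ m₁ ∷ m₂ ∷ n₁ ∷ n₂ ∷ [])))
    ; second = *-cancelˡ-pos {Q} (Q′ * m₂) ((n₁ - a * m₁) + P′ * (n₂ - a * m₂)) 1≤Q
        (by-combination (m₂ · QQ′≡d-P′² ⊕ -1ℤ · first ⊕ (- P′) · second ⊕ (- (m₂ * P′ + m₁)) · P+P′≡aQ)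
          (solve (d ∷ P ∷ Q ∷ P′ ∷ Q′ ∷ a ∷ m₁ ∷ m₂ ∷ n₁ ∷ n₂ ∷ [])))
    ; unimodular = subst (_≡± 1ℤ) det-flips (≡±-neg unimodular)
    ; alternating = alternating-step a (partial-quotient-positive r s) alternating
    }
    where
    open IsReduced r
    open Tracks t
    det-flips : - (m₁ * n₂ - m₂ * n₁) ≡ (n₁ - a * m₁) * m₂ - (n₂ - a * m₂) * m₁
    det-flips = solve (a ∷ m₁ ∷ m₂ ∷ n₁ ∷ n₂ ∷ [])

  Invariant : State × Convergents → Set
  Invariant (state P Q R , convergents m₁ m₂ n₁ n₂) = IsReduced P Q R × Tracks P Q m₁ m₂ n₁ n₂

  advance-invariant : ∀ {z} → Invariant z → Invariant (advance z)
  advance-invariant {state P Q R , _} (r , t) = reduced-successor r (step-successor r) , tracks-successor r (step-successor r) t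

  x₁ : State
  x₁ = state S (d - S * S) 1ℤ

  start : State × Convergents
  start = x₁ , convergents (- S) 1ℤ 1ℤ 0ℤ

  x₁-reduced : IsReduced S (d - S * S) 1ℤ
  x₁-reduced = record
    { 1≤P = 1≤S
    ; P≤S = i≤j⇒0≤j-i (≤-refl {S})
    ; S<P+Q = by-nonNeg S²<d (solve (S ∷ d ∷ []))
    ; Q≤S+P = by-nonNeg d<[S+1]² (solve (S ∷ d ∷ []))
    ; QR≡d-P² = *-identityʳ (d - S * S)
    }

  start-tracks : Tracks S (d - S * S) (- S) 1ℤ 1ℤ 0ℤ
  start-tracks = record
    { first = solve (S ∷ d ∷ [])
    ; second = solve (S ∷ d ∷ [])
    ; unimodular = inj₂ (solve (S ∷ []))
    ; alternating = 1ℤ , 0≤+ 0 , 0≤+ 0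
    }

  start-invariant : Invariant start
  start-invariant = x₁-reduced , start-tracks

  trajectory-state : ∀ n → proj₁ (fold start advance n) ≡ fold x₁ step n
  trajectory-state zero = refl
  trajectory-state (suc n) = cong step (trajectory-state n)

  unit-from-return : ∀ {m₁ m₂ n₁ n₂} → Tracks S (d - S * S) m₁ m₂ n₁ n₂ → n₁ * n₁ - d * (n₂ * n₂) ≡± 1ℤ
  unit-from-return {m₁} {m₂} {n₁} {n₂} t = subst (_≡± 1ℤ) (sym norm≡-det) (≡±-neg unimodular)
    where
    open Tracks t
    m₂≡n₁-Sn₂ : n₁ - S * n₂ - m₂ ≡ 0ℤ
    m₂≡n₁-Sn₂ = *-cancelˡ-pos {d - S * S} (n₁ - S * n₂ - m₂) 0ℤ S²<d
      (by-combination (1ℤ · first ⊕ (- S) · second) (solve (S ∷ d ∷ m₁ ∷ m₂ ∷ n₁ ∷ n₂ ∷ [])))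
    norm≡-det : n₁ * n₁ - d * (n₂ * n₂) ≡ - (m₁ * n₂ - m₂ * n₁)
    norm≡-det = by-combination ((n₁ + S * n₂) · m₂≡n₁-Sn₂ ⊕ (- n₂) · second)
                               (solve (S ∷ d ∷ m₁ ∷ m₂ ∷ n₁ ∷ n₂ ∷ []))

  pell : NontrivialUnit d
  pell = from-return (fold start advance m) (fold-preserves Invariant advance-invariant start-invariant m)
           (trans (cong step (trajectory-state m)) returns)
    where
    period = orbit-returns step Reduced step-reduced step-injective code code-injective (proj₁ start-invariant)
    m = proj₁ period
    returns = proj₂ period
    from-return : ∀ z → Invariant z → step (proj₁ z) ≡ x₁ → NontrivialUnit d
    from-return (x , convergents m₁ m₂ n₁ n₂) i@(_ , t) returned =
      m₁ , m₂ , alternating⇒≢0 (Tracks.alternating t) ,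
      unit-from-return (subst Tracks-at returned (proj₂ (advance-invariant {x , convergents m₁ m₂ n₁ n₂} i)))
      where
      Tracks-at : State → Set
      Tracks-at y = Tracks (State.P y) (State.Q y) (n₁ - partial-quotient x * m₁) (n₂ - partial-quotient x * m₂) m₁ m₂

pell-equation : ∀ n → (∀ t → t ℕ.* t ≢ n) → NontrivialUnit (+ n)
pell-equation n nonsquare = Pell.pell (+ s) (+ n) 1≤s s²<n n<[s+1]²
  where
  s = proj₁ (isqrt n)
  s²≤n = proj₁ (proj₂ (isqrt n))
  n<[s+1]²ℕ = proj₂ (proj₂ (isqrt n))
  +suc : ∀ m → + suc m ≡ + m + 1ℤ
  +suc m = trans (cong +_ (ℕₚ.+-comm 1 m)) (pos-+ m 1)
  1≤s : 0ℤ ≤ + s - 1ℤ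
  1≤s with s | n<[s+1]²ℕ
  ... | zero | ℕ.s≤s n≤0 = ⊥-elim (nonsquare 0 (sym (ℕₚ.n≤0⇒n≡0 n≤0)))
  ... | suc s-1 | _ = 0≤+ s-1
  s²<n : 0ℤ ≤ + n - + s * + s - 1ℤ
  s²<n = subst (λ m → 0ℤ ≤ + n - m - 1ℤ) (pos-* s s) (0≤-of-ℕ< (ℕₚ.≤∧≢⇒< s²≤n (nonsquare s)))
  n<[s+1]² : 0ℤ ≤ (+ s + 1ℤ) * (+ s + 1ℤ) - + n - 1ℤ
  n<[s+1]² = subst (λ m → 0ℤ ≤ m - + n - 1ℤ) (trans (pos-* (suc s) (suc s)) (cong₂ _*_ (+suc s) (+suc s)))
                   (0≤-of-ℕ< n<[s+1]²ℕ)

-- Descent from a unit to an element of norm ±p or ±q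

record CoprimeSplit (A B : ℤ) : Set where
  constructor split
  field
    g a b u v : ℤ
    A≡ag : A ≡ a * g
    B≡bg : B ≡ b * g
    ua+vb≡1 : u * a + v * b ≡ 1ℤ
    1≤g : 0ℤ ≤ g - 1ℤ

abs-sign : ∀ A → Σ ℤ λ σ → + ∣ A ∣ ≡ σ * A
abs-sign (+ n) = 1ℤ , sym (*-identityˡ (+ n))
abs-sign -[1+ n ] = -1ℤ , sym (-1*i≡-i -[1+ n ])

ℕ-identity : ∀ {d m n x y} → d ℕ.+ y ℕ.* n ≡ x ℕ.* m → + d + + y * + n ≡ + x * + m
ℕ-identity {d} {m} {n} {x} {y} eq =
  trans (cong (λ t → + d + t) (sym (pos-* y n))) (trans (sym (pos-+ d (y ℕ.* n))) (trans (cong +_ eq) (pos-* x m)))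

coprime-split : ∀ A B → B ≢ 0ℤ → CoprimeSplit A B
coprime-split A B B≢0 = from-bezout (Bézout.lemma ∣ A ∣ ∣ B ∣)
  where
  σA = proj₁ (abs-sign A)
  σB = proj₁ (abs-sign B)
  from-bezout : Bézout.Lemma ∣ A ∣ ∣ B ∣ → CoprimeSplit A B
  from-bezout (Bézout.result zero gcd _) = ⊥-elim (B≢0 (∣i∣≡0⇒i≡0 (ℕᵈ.0∣⇒≡0 (GCD.gcd∣n gcd))))
  from-bezout (Bézout.result (suc G-1) gcd identity) =
    from-identity (∣ᵤ⇒∣ (GCD.gcd∣m gcd)) (∣ᵤ⇒∣ (GCD.gcd∣n gcd)) identity
    where
    G = + suc G-1
    from-identity : G ∣ A → G ∣ B → Bézout.Identity (suc G-1) ∣ A ∣ ∣ B ∣ → CoprimeSplit A B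
    from-identity (divides a A≡aG) (divides b B≡bG) (Bézout.+- x y eq) =
      split G a b (+ x * σA) (- (+ y * σB)) A≡aG B≡bG
        (*-cancelˡ-pos {G} (+ x * σA * a + - (+ y * σB) * b) 1ℤ (0≤+ G-1)
          (lifted-identity {G} {+ x} {+ y} {A} {B} {+ ∣ A ∣} {+ ∣ B ∣} {σA} {σB} {a} {b}
            (proj₂ (abs-sign A)) (proj₂ (abs-sign B)) A≡aG B≡bG (ℕ-identity {suc G-1} {∣ A ∣} {∣ B ∣} {x} {y} eq)))
        (0≤+ G-1)
      where
      lifted-identity : ∀ {G X Y A B Aabs Babs σA σB a b} → Aabs ≡ σA * A → Babs ≡ σB * B → A ≡ a * G → B ≡ b * G →
                G + Y * Babs ≡ X * Aabs → G * (X * σA * a + - (Y * σB) * b) ≡ G * 1ℤ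
      lifted-identity {G} {X} {Y} {A} {B} {Aabs} {Babs} {σA} {σB} {a} {b} eA eB A≡aG B≡bG eq =
        by-combination (-1ℤ · eq ⊕ (- X) · eA ⊕ Y · eB ⊕ (- (X * σA)) · A≡aG ⊕ (Y * σB) · B≡bG)
          (solve (G ∷ X ∷ Y ∷ A ∷ B ∷ Aabs ∷ Babs ∷ σA ∷ σB ∷ a ∷ b ∷ []))
    from-identity (divides a A≡aG) (divides b B≡bG) (Bézout.-+ x y eq) =
      split G a b (- (+ x * σA)) (+ y * σB) A≡aG B≡bG
        (*-cancelˡ-pos {G} (- (+ x * σA) * a + + y * σB * b) 1ℤ (0≤+ G-1)
          (lifted-identity {G} {+ x} {+ y} {A} {B} {+ ∣ A ∣} {+ ∣ B ∣} {σA} {σB} {a} {b}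
            (proj₂ (abs-sign A)) (proj₂ (abs-sign B)) A≡aG B≡bG (ℕ-identity {suc G-1} {∣ B ∣} {∣ A ∣} {y} {x} eq)))
        (0≤+ G-1)
      where
      lifted-identity : ∀ {G X Y A B Aabs Babs σA σB a b} → Aabs ≡ σA * A → Babs ≡ σB * B → A ≡ a * G → B ≡ b * G →
                G + X * Aabs ≡ Y * Babs → G * (- (X * σA) * a + Y * σB * b) ≡ G * 1ℤ
      lifted-identity {G} {X} {Y} {A} {B} {Aabs} {Babs} {σA} {σB} {a} {b} eA eB A≡aG B≡bG eq =
        by-combination (-1ℤ · eq ⊕ X · eA ⊕ (- Y) · eB ⊕ (X * σA) · A≡aG ⊕ (- (Y * σB)) · B≡bG)
          (solve (G ∷ X ∷ Y ∷ A ∷ B ∷ Aabs ∷ Babs ∷ σA ∷ σB ∷ a ∷ b ∷ []))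

abs-unit : ∀ {σ} → σ ≡± 1ℤ → ∣ σ ∣ ≡ 1
abs-unit (inj₁ refl) = refl
abs-unit (inj₂ refl) = refl

shorter : ∀ {σ y s t} → σ * y ≡ + 2 * s * t → σ ≡± 1ℤ → y ≢ 0ℤ → ∣ t ∣ ℕ.< ∣ y ∣ × t ≢ 0ℤ
shorter {σ} {y} {s} {t} σy≡2st σ≡±1 y≢0 =
  ℕ-shorter ∣ s ∣ ∣ t ∣ ∣y∣≡2∣s∣∣t∣ (λ ∣y∣≡0 → y≢0 (∣i∣≡0⇒i≡0 ∣y∣≡0)) , t≢0
  where
  ∣y∣≡2∣s∣∣t∣ : ∣ y ∣ ≡ 2 ℕ.* ∣ s ∣ ℕ.* ∣ t ∣
  ∣y∣≡2∣s∣∣t∣ = begin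
    ∣ y ∣                ≡⟨ ℕₚ.*-identityˡ ∣ y ∣ ⟨
    1 ℕ.* ∣ y ∣          ≡⟨ cong (ℕ._* ∣ y ∣) (abs-unit σ≡±1) ⟨
    ∣ σ ∣ ℕ.* ∣ y ∣      ≡⟨ abs-* σ y ⟨
    ∣ σ * y ∣            ≡⟨ cong ∣_∣ σy≡2st ⟩
    ∣ + 2 * s * t ∣      ≡⟨ abs-* (+ 2 * s) t ⟩
    ∣ + 2 * s ∣ ℕ.* ∣ t ∣ ≡⟨ cong (ℕ._* ∣ t ∣) (abs-* (+ 2) s) ⟩
    2 ℕ.* ∣ s ∣ ℕ.* ∣ t ∣ ∎
    where open ≡-Reasoning
  ℕ-shorter : ∀ S T {Y} → Y ≡ 2 ℕ.* S ℕ.* T → Y ≢ 0 → T ℕ.< Y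
  ℕ-shorter zero T refl Y≢0 = ⊥-elim (Y≢0 refl)
  ℕ-shorter (suc S) zero refl Y≢0 = ⊥-elim (Y≢0 (ℕₚ.*-zeroʳ (2 ℕ.* suc S)))
  ℕ-shorter (suc S) (suc T) refl _ = ℕₚ.≤-<-trans (ℕₚ.m≤n*m (suc T) (suc S))
    (subst (suc S ℕ.* suc T ℕ.<_) (sym (ℕₚ.*-assoc 2 (suc S) (suc T))) (ℕₚ.m<m+n (suc S ℕ.* suc T) ℕ.z<s))
  t≢0 : t ≢ 0ℤ
  t≢0 refl = y≢0 (∣i∣≡0⇒i≡0 (trans ∣y∣≡2∣s∣∣t∣ (ℕₚ.*-zeroʳ (2 ℕ.* ∣ s ∣))))

≡±-as-unit : ∀ {x c} → x ≡± c → Σ ℤ λ σ → σ ≡± 1ℤ × x ≡ σ * c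
≡±-as-unit {x} {c} (inj₁ x≡c) = 1ℤ , inj₁ refl , trans x≡c (sym (*-identityˡ c))
≡±-as-unit {x} {c} (inj₂ x≡-c) = -1ℤ , inj₂ refl , trans x≡-c (sym (-1*i≡-i c))

_≡±?_ : ∀ x c → Dec (x ≡± c)
x ≡±? c = (x ≟ c) ⊎-dec (x ≟ - c)

odd-divisor : ∀ {d n K} → + 2 * d ≡ K * n → (Σ ℤ λ m → n ≡ + 2 * m + 1ℤ) → n ∣ d
odd-divisor {d} {n} {K} 2d≡Kn (m , n≡2m+1) = from-parity (parity K)
  where
  from-parity : (Σ ℤ λ k → K ≡ + 2 * k ⊎ K ≡ + 2 * k + 1ℤ) → n ∣ d
  from-parity (k , inj₁ K≡2k) = divides k (*-cancelˡ-≡ (+ 2) d (k * n)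
    (by-combination (1ℤ · 2d≡Kn ⊕ n · K≡2k) (solve (d ∷ n ∷ K ∷ k ∷ []))))
  from-parity (k , inj₂ K≡2k+1) = ⊥-elim (even≢odd d (+ 2 * k * m + k + m)
    (by-combination (1ℤ · 2d≡Kn ⊕ n · K≡2k+1 ⊕ (+ 2 * k + 1ℤ) · n≡2m+1) (solve (d ∷ n ∷ K ∷ k ∷ m ∷ []))))

module Descent (d D : ℤ) (d≡4D+1 : d ≡ + 4 * D + 1ℤ) (1≤d : 0ℤ ≤ d - 1ℤ)
  (squarefree : ∀ a → d ∣ a * a → d ∣ a)
  (no-negative-unit : ∀ x y → x * x - d * (y * y) ≢ -1ℤ) where

  record Solution : Set where
    constructor solution
    field
      x y : ℤ
      y≢0 : y ≢ 0ℤ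
      norm≡1 : x * x - d * (y * y) ≡ 1ℤ

  record ProperDivisorNorm : Set where
    constructor element
    field
      a b : ℤ
      norm∣d : a * a - d * (b * b) ∣ d
      norm≢±1 : ¬ (a * a - d * (b * b) ≡± 1ℤ)
      norm≢±d : ¬ (a * a - d * (b * b) ≡± d)

  unit-norm : ∀ x y → x * x - d * (y * y) ≡± 1ℤ → x * x - d * (y * y) ≡ 1ℤ
  unit-norm x y (inj₁ N≡1) = N≡1
  unit-norm x y (inj₂ N≡-1) = ⊥-elim (no-negative-unit x y N≡-1)

  norm-odd : ∀ a b u v K → u * a + v * b ≡ 1ℤ → + 2 * d ≡ K * (a * a - d * (b * b)) →
    Σ ℤ λ m → a * a - d * (b * b) ≡ + 2 * m + 1ℤ
  norm-odd a b u v K ua+vb≡1 2d≡Kn = by-parity (parity a) (parity b)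
    where
    by-parity : (Σ ℤ λ a′ → a ≡ + 2 * a′ ⊎ a ≡ + 2 * a′ + 1ℤ) → (Σ ℤ λ b′ → b ≡ + 2 * b′ ⊎ b ≡ + 2 * b′ + 1ℤ) →
                Σ ℤ λ m → a * a - d * (b * b) ≡ + 2 * m + 1ℤ
    by-parity (a′ , inj₁ refl) (b′ , inj₁ refl) = ⊥-elim (even≢odd (u * a′ + v * b′) 0ℤ
      (by-combination (1ℤ · ua+vb≡1) (solve (u ∷ v ∷ a′ ∷ b′ ∷ []))))
    by-parity (a′ , inj₁ refl) (b′ , inj₂ refl) = + 2 * (a′ * a′) - + 2 * d * (b′ * b′ + b′) - + 2 * D - 1ℤ ,
      by-combination (-1ℤ · d≡4D+1) (solve (d ∷ D ∷ a′ ∷ b′ ∷ []))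
    by-parity (a′ , inj₂ refl) (b′ , inj₁ refl) = + 2 * (a′ * a′ + a′) - + 2 * d * (b′ * b′) ,
      solve (d ∷ a′ ∷ b′ ∷ [])
    by-parity (a′ , inj₂ refl) (b′ , inj₂ refl) =
      ⊥-elim (even≢odd (K * t) (+ 2 * D) (*-cancelˡ-≡ (+ 2) (+ 2 * (K * t)) (+ 2 * (+ 2 * D) + 1ℤ) Kn≡2d))
      where
      t = a′ * a′ + a′ - d * (b′ * b′ + b′) - D
      Kn≡2d : + 2 * (+ 2 * (K * (a′ * a′ + a′ - d * (b′ * b′ + b′) - D))) ≡ + 2 * (+ 2 * (+ 2 * D) + 1ℤ)
      Kn≡2d = by-combination (-1ℤ · 2d≡Kn ⊕ (K + + 2) · d≡4D+1) (solve (d ∷ D ∷ K ∷ a′ ∷ b′ ∷ []))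

  Shorter : ℤ → Set
  Shorter y = Σ Solution λ s → ∣ Solution.y s ∣ ℕ.< ∣ y ∣

  module Step {x y g a b u v : ℤ} (y≢0 : y ≢ 0ℤ) (norm≡1 : x * x - d * (y * y) ≡ 1ℤ)
    (1+x≡ag : 1ℤ + x ≡ a * g) (y≡bg : y ≡ b * g) (ua+vb≡1 : u * a + v * b ≡ 1ℤ) (1≤g : 0ℤ ≤ g - 1ℤ) where

    R₁ : a * (x - 1ℤ) ≡ d * y * b
    R₁ = *-cancelˡ-pos {g} (a * (x - 1ℤ)) (d * y * b) 1≤g
      (by-combination ((- (x - 1ℤ)) · 1+x≡ag ⊕ (d * y) · y≡bg ⊕ 1ℤ · norm≡1) (solve (d ∷ x ∷ y ∷ g ∷ a ∷ b ∷ [])))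

    R₂ : b * (1ℤ + x) ≡ y * a
    R₂ = *-cancelˡ-pos {g} (b * (1ℤ + x)) (y * a) 1≤g
      (by-combination (y · 1+x≡ag ⊕ (- (1ℤ + x)) · y≡bg) (solve (x ∷ y ∷ g ∷ a ∷ b ∷ [])))

    ny≡2ab : (a * a - d * (b * b)) * y ≡ + 2 * a * b
    ny≡2ab = by-combination (b · R₁ ⊕ (- a) · R₂) (solve (d ∷ x ∷ y ∷ a ∷ b ∷ []))

    n[x+1]≡2a² : (a * a - d * (b * b)) * (x + 1ℤ) ≡ + 2 * (a * a)
    n[x+1]≡2a² = by-combination (a · R₁ ⊕ (- (d * b)) · R₂) (solve (d ∷ x ∷ y ∷ a ∷ b ∷ []))

    n[x-1]≡2db² : (a * a - d * (b * b)) * (x - 1ℤ) ≡ + 2 * d * (b * b)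
    n[x-1]≡2db² = by-combination (a · R₁ ⊕ (- (d * b)) · R₂) (solve (d ∷ x ∷ y ∷ a ∷ b ∷ []))

    K = d * u * u * (x + 1ℤ) + + 2 * d * u * v * y + v * v * (x - 1ℤ)

    2d≡Kn : + 2 * d ≡ (d * u * u * (x + 1ℤ) + + 2 * d * u * v * y + v * v * (x - 1ℤ)) * (a * a - d * (b * b))
    2d≡Kn = by-combination ((- (+ 2 * d * u * v)) · ny≡2ab ⊕ (- (d * u * u)) · n[x+1]≡2a² ⊕ (- (v * v)) · n[x-1]≡2db²
                            ⊕ (- (+ 2 * d * (u * a + v * b + 1ℤ))) · ua+vb≡1)
              (solve (d ∷ x ∷ y ∷ a ∷ b ∷ u ∷ v ∷ []))

    n∣d : a * a - d * (b * b) ∣ d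
    n∣d = odd-divisor {d} {a * a - d * (b * b)} {K} 2d≡Kn (norm-odd a b u v K ua+vb≡1 2d≡Kn)

    from-unit-norm : a * a - d * (b * b) ≡± 1ℤ → Shorter y
    from-unit-norm n≡±1 = solution a b (proj₂ b-shorter) (unit-norm a b n≡±1) , proj₁ b-shorter
      where b-shorter = shorter {a * a - d * (b * b)} {y} {a} {b} ny≡2ab n≡±1 y≢0

    from-norm-±d : a * a - d * (b * b) ≡± d → Shorter y
    from-norm-±d n≡±d = from-unit (≡±-as-unit n≡±d)
      where
      from-unit : (Σ ℤ λ σ → σ ≡± 1ℤ × a * a - d * (b * b) ≡ σ * d) → Shorter y
      from-unit (σ , σ≡±1 , n≡σd) =
        from-multiple (squarefree a (divides (b * b + σ) (by-combination (1ℤ · n≡σd) (solve (d ∷ a ∷ b ∷ σ ∷ [])))))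
        where
        from-multiple : d ∣ a → Shorter y
        from-multiple (divides a₃ a≡a₃d) =
          solution b a₃ (proj₂ a₃-shorter) (unit-norm b a₃ (subst (_≡± 1ℤ) (sym norm≡-σ) (≡±-neg σ≡±1))) , proj₁ a₃-shorter
          where
          norm≡-σ : b * b - d * (a₃ * a₃) ≡ - σ
          norm≡-σ = *-cancelˡ-pos {d} (b * b - d * (a₃ * a₃)) (- σ) 1≤d
            (by-combination (-1ℤ · n≡σd ⊕ (a + a₃ * d) · a≡a₃d) (solve (d ∷ a ∷ b ∷ σ ∷ a₃ ∷ [])))
          σy≡2ba₃ : σ * y ≡ + 2 * b * a₃
          σy≡2ba₃ = *-cancelˡ-pos {d} (σ * y) (+ 2 * b * a₃) 1≤d
            (by-combination (1ℤ · ny≡2ab ⊕ (- y) · n≡σd ⊕ (+ 2 * b) · a≡a₃d) (solve (d ∷ y ∷ a ∷ b ∷ σ ∷ a₃ ∷ [])))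
          a₃-shorter = shorter {σ} {y} {b} {a₃} σy≡2ba₃ σ≡±1 y≢0

    result : ProperDivisorNorm ⊎ Shorter y
    result = classify ((a * a - d * (b * b)) ≡±? 1ℤ) ((a * a - d * (b * b)) ≡±? d)
      where
      classify : Dec (a * a - d * (b * b) ≡± 1ℤ) → Dec (a * a - d * (b * b) ≡± d) → ProperDivisorNorm ⊎ Shorter y
      classify (yes n≡±1) _ = inj₂ (from-unit-norm n≡±1)
      classify (no _) (yes n≡±d) = inj₂ (from-norm-±d n≡±d)
      classify (no n≢±1) (no n≢±d) = inj₁ (element a b n∣d n≢±1 n≢±d)

  descent-step : (s : Solution) → ProperDivisorNorm ⊎ Shorter (Solution.y s)
  descent-step (solution x y y≢0 norm≡1) = from-split (coprime-split (1ℤ + x) y y≢0)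
    where
    from-split : CoprimeSplit (1ℤ + x) y → ProperDivisorNorm ⊎ Shorter y
    from-split (split g a b u v 1+x≡ag y≡bg ua+vb≡1 1≤g) =
      Step.result {x} {y} {g} {a} {b} {u} {v} y≢0 norm≡1 1+x≡ag y≡bg ua+vb≡1 1≤g

  descent : Solution → ProperDivisorNorm
  descent s = <-rec (λ n → ∀ s → ∣ Solution.y s ∣ ≡ n → ProperDivisorNorm) descend ∣ Solution.y s ∣ s refl
    where
    descend : ∀ n → (∀ {m} → m ℕ.< n → ∀ s → ∣ Solution.y s ∣ ≡ m → ProperDivisorNorm) →
              ∀ s → ∣ Solution.y s ∣ ≡ n → ProperDivisorNorm
    descend _ smaller s refl = [ id , (λ { (s′ , s′-shorter) → smaller s′-shorter s′ refl }) ]′ (descent-step s)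

-- The prime ideal (a + b√d) of norm p and its lattice

≡±1⇒square≡1 : ∀ {ε} → ε ≡± 1ℤ → ε * ε ≡ 1ℤ
≡±1⇒square≡1 (inj₁ refl) = refl
≡±1⇒square≡1 (inj₂ refl) = refl

odd≢0 : ∀ k → + 2 * k + 1ℤ ≢ 0ℤ
odd≢0 k 2k+1≡0 = even≢odd 0ℤ k (sym 2k+1≡0)

-- The cases x₂ odd, x₂ ≠ 0 even and x₂ = 0 need nothing, R ≤ 3S and S ≤ 3R respectively.
odd-lattice-minimum : ∀ {R S K} → R ≡ + 2 * K + 1ℤ → 0ℤ ≤ R - 1ℤ → 0ℤ ≤ S - 1ℤ →
  0ℤ ≤ + 3 * S - R → 0ℤ ≤ + 3 * R - S → ∀ c x₂ → + 2 ∣ c * R - x₂ → ¬ (c * R ≡ 0ℤ × x₂ ≡ 0ℤ) →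
  0ℤ ≤ c * R * (c * R) + R * S * (x₂ * x₂) - (R * R + R * S * (1ℤ * 1ℤ))
odd-lattice-minimum {R} {S} {K} R≡2K+1 1≤R 1≤S R≤3S S≤3R c x₂ (divides t cR-x₂≡2t) nonzero = from-parity (parity x₂)
  where
  0≤R : 0ℤ ≤ R
  0≤R = by-nonNeg (+-mono-≤ 1≤R (0≤+ 1)) (solve (R ∷ []))
  0≤S : 0ℤ ≤ S
  0≤S = by-nonNeg (+-mono-≤ 1≤S (0≤+ 1)) (solve (S ∷ []))
  from-parity : (Σ ℤ λ k → x₂ ≡ + 2 * k ⊎ x₂ ≡ + 2 * k + 1ℤ) →
                0ℤ ≤ c * R * (c * R) + R * S * (x₂ * x₂) - (R * R + R * S * (1ℤ * 1ℤ))
  from-parity (k , x₂≡2k⊎2k+1) = [ even k , odd k ]′ x₂≡2k⊎2k+1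
    where
    odd : ∀ k → x₂ ≡ + 2 * k + 1ℤ → 0ℤ ≤ c * R * (c * R) + R * S * (x₂ * x₂) - (R * R + R * S * (1ℤ * 1ℤ))
    odd k x₂≡2k+1 = by-nonNeg
      (+-mono-≤ (0≤-* (0≤-square R) (0≤-square-1 c c≢0)) (0≤-* (0≤-* 0≤R 0≤S) (0≤-square-1 x₂ x₂≢0)))
      (solve (R ∷ S ∷ c ∷ x₂ ∷ []))
      where
      x₂≢0 : x₂ ≢ 0ℤ
      x₂≢0 x₂≡0 = odd≢0 k (trans (sym x₂≡2k+1) x₂≡0)
      c≢0 : c ≢ 0ℤ
      c≢0 c≡0 = even≢odd t (- k - 1ℤ)
        (by-combination (-1ℤ · cR-x₂≡2t ⊕ -1ℤ · x₂≡2k+1 ⊕ R · c≡0) (solve (R ∷ c ∷ x₂ ∷ t ∷ k ∷ [])))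
    even : ∀ k → x₂ ≡ + 2 * k → 0ℤ ≤ c * R * (c * R) + R * S * (x₂ * x₂) - (R * R + R * S * (1ℤ * 1ℤ))
    even k x₂≡2k = [ x₂≡0⇒goal , k≢0⇒goal ]′ (toSum (k ≟ 0ℤ))
      where
      k≢0⇒goal : k ≢ 0ℤ → 0ℤ ≤ c * R * (c * R) + R * S * (x₂ * x₂) - (R * R + R * S * (1ℤ * 1ℤ))
      k≢0⇒goal k≢0 = by-nonNeg
        (+-mono-≤ (+-mono-≤ (0≤-square (c * R)) (0≤-* (0≤-* (0≤+ 4) (0≤-* 0≤R 0≤S)) (0≤-square-1 k k≢0))) (0≤-* 0≤R R≤3S))
        (by-combination ((R * S * (x₂ + + 2 * k)) · x₂≡2k) (solve (R ∷ S ∷ c ∷ x₂ ∷ k ∷ [])))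
      x₂≡0⇒goal : k ≡ 0ℤ → 0ℤ ≤ c * R * (c * R) + R * S * (x₂ * x₂) - (R * R + R * S * (1ℤ * 1ℤ))
      x₂≡0⇒goal k≡0 = from-c-parity (parity c)
        where
        x₂≡0 : x₂ ≡ 0ℤ
        x₂≡0 = trans x₂≡2k (cong (λ k → + 2 * k) k≡0)
        c-odd : ∀ c′ → ¬ (c ≡ + 2 * c′ + 1ℤ)
        c-odd c′ c≡2c′+1 = even≢odd t (+ 2 * c′ * K + c′ + K)
          (by-combination (-1ℤ · cR-x₂≡2t ⊕ -1ℤ · x₂≡0 ⊕ (+ 2 * c′ + 1ℤ) · R≡2K+1 ⊕ R · c≡2c′+1)
            (solve (R ∷ K ∷ c ∷ x₂ ∷ t ∷ c′ ∷ [])))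
        c-even : ∀ c′ → c ≡ + 2 * c′ → 0ℤ ≤ c * R * (c * R) + R * S * (x₂ * x₂) - (R * R + R * S * (1ℤ * 1ℤ))
        c-even c′ c≡2c′ = by-nonNeg
          (+-mono-≤ (0≤-* (0≤-* (0≤+ 4) (0≤-square R)) (0≤-square-1 c′ c′≢0)) (0≤-* 0≤R S≤3R))
          (by-combination ((R * R * (c + + 2 * c′)) · c≡2c′ ⊕ (R * S * x₂) · x₂≡0) (solve (R ∷ S ∷ c ∷ x₂ ∷ c′ ∷ [])))
          where
          c′≢0 : c′ ≢ 0ℤ
          c′≢0 c′≡0 = nonzero (by-combination (R · c≡2c′ ⊕ (+ 2 * R) · c′≡0) (solve (R ∷ c ∷ c′ ∷ [])) , x₂≡0)
        from-c-parity : (Σ ℤ λ c′ → c ≡ + 2 * c′ ⊎ c ≡ + 2 * c′ + 1ℤ) →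
                        0ℤ ≤ c * R * (c * R) + R * S * (x₂ * x₂) - (R * R + R * S * (1ℤ * 1ℤ))
        from-c-parity (c′ , c≡2c′⊎2c′+1) = [ c-even c′ , (λ c≡2c′+1 → ⊥-elim (c-odd c′ c≡2c′+1)) ]′ c≡2c′⊎2c′+1

module PrimeIdeal (R S K Kₛ a′ b ε : ℤ)
  (R≡2K+1 : R ≡ + 2 * K + 1ℤ) (S≡2Kₛ+1 : S ≡ + 2 * Kₛ + 1ℤ) (3≤R : 0ℤ ≤ R - + 3) (1≤S : 0ℤ ≤ S - 1ℤ)
  (R≤3S : 0ℤ ≤ + 3 * S - R) (S≤3R : 0ℤ ≤ + 3 * R - S)
  (euclid-R : ∀ m n → R ∣ m * n → (R ∣ m) ⊎ (R ∣ n))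
  (ε≡±1 : ε ≡± 1ℤ) (reduced-norm : R * (a′ * a′) - S * (b * b) ≡ ε) where

  -- γ = a′R + b√d, of norm R² a′² - RS b² = εR.
  γ : Elt
  γ = + 2 * (a′ * R) , + 2 * b

  Lattice : Elt → Set
  Lattice (x₁ , x₂) = InOK (x₁ , x₂) × R ∣ x₁

  1≤R : 0ℤ ≤ R - 1ℤ
  1≤R = by-nonNeg (+-mono-≤ 3≤R (0≤+ 2)) (solve (R ∷ []))

  0≤R : 0ℤ ≤ R
  0≤R = by-nonNeg (+-mono-≤ 3≤R (0≤+ 3)) (solve (R ∷ []))

  principal⇒lattice : ∀ x → InPrincipal (R * S) γ x → Lattice x
  principal⇒lattice (x₁ , x₂) ((δ₁ , δ₂) , δ∈O , γδ≡x) = ∣⇒∣ᵤ (from-δ∈O (∣ᵤ⇒∣ δ∈O)) , divides (a′ * δ₁ + S * b * δ₂) x₁≡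
    where
    first : + 2 * (a′ * R) * δ₁ + R * S * (+ 2 * b * δ₂) ≡ x₁ * + 2 + R * S * (x₂ * + 0)
    first = cong proj₁ γδ≡x
    second : + 2 * (a′ * R) * δ₂ + + 2 * b * δ₁ ≡ x₁ * + 0 + x₂ * + 2
    second = cong proj₂ γδ≡x
    x₁≡ : x₁ ≡ (a′ * δ₁ + S * b * δ₂) * R
    x₁≡ = *-cancelˡ-≡ (+ 2) x₁ ((a′ * δ₁ + S * b * δ₂) * R)
      (by-combination (-1ℤ · first) (solve (R ∷ S ∷ a′ ∷ b ∷ x₁ ∷ x₂ ∷ δ₁ ∷ δ₂ ∷ [])))
    x₂≡ : x₂ ≡ a′ * R * δ₂ + b * δ₁
    x₂≡ = *-cancelˡ-≡ (+ 2) x₂ (a′ * R * δ₂ + b * δ₁)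
      (by-combination (-1ℤ · second) (solve (R ∷ a′ ∷ b ∷ x₁ ∷ x₂ ∷ δ₁ ∷ δ₂ ∷ [])))
    from-δ∈O : + 2 ∣ δ₁ - δ₂ → + 2 ∣ x₁ - x₂
    from-δ∈O (divides t δ₁-δ₂≡2t) = divides ((a′ * R - b) * t + b * (+ 2 * K * Kₛ + K + Kₛ) * δ₂)
      (by-combination (1ℤ · x₁≡ ⊕ -1ℤ · x₂≡ ⊕ (a′ * R - b) · δ₁-δ₂≡2t ⊕ (b * δ₂ * S) · R≡2K+1 ⊕ (b * δ₂ * (+ 2 * K + 1ℤ)) · S≡2Kₛ+1)
        (solve (R ∷ S ∷ K ∷ Kₛ ∷ a′ ∷ b ∷ x₁ ∷ x₂ ∷ δ₁ ∷ δ₂ ∷ t ∷ [])))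

  lattice⇒principal : ∀ x → Lattice x → InPrincipal (R * S) γ x
  lattice⇒principal (x₁ , x₂) (x∈O , divides c x₁≡cR) = (δ₁ , δ₂) , ∣⇒∣ᵤ (from-x∈O (∣ᵤ⇒∣ x∈O)) , cong₂ _,_ first second
    where
    δ₁ = ε * (c * a′ * R - S * x₂ * b)
    δ₂ = ε * (x₂ * a′ - c * b)
    εε≡1 : ε * ε ≡ 1ℤ
    εε≡1 = ≡±1⇒square≡1 ε≡±1
    from-x∈O : + 2 ∣ x₁ - x₂ → + 2 ∣ ε * (c * a′ * R - S * x₂ * b) - ε * (x₂ * a′ - c * b)
    from-x∈O (divides t x₁-x₂≡2t) = divides (ε * (c * a′ * K - Kₛ * x₂ * b + (t - c * K) * (a′ + b)))
      (by-combination ((- (ε * c * b)) · R≡2K+1 ⊕ (- (ε * x₂ * b)) · S≡2Kₛ+1 ⊕ (ε * (a′ + b)) · x₁-x₂≡2t ⊕ (- (ε * (a′ + b))) · x₁≡cR)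
        (solve (R ∷ S ∷ K ∷ Kₛ ∷ a′ ∷ b ∷ ε ∷ x₁ ∷ x₂ ∷ c ∷ t ∷ [])))
    first : + 2 * (a′ * R) * (ε * (c * a′ * R - S * x₂ * b)) + R * S * (+ 2 * b * (ε * (x₂ * a′ - c * b)))
            ≡ x₁ * + 2 + R * S * (x₂ * + 0)
    first = by-combination ((+ 2 * ε * c * R) · reduced-norm ⊕ (+ 2 * c * R) · εε≡1 ⊕ (- + 2) · x₁≡cR)
      (solve (R ∷ S ∷ a′ ∷ b ∷ ε ∷ x₁ ∷ x₂ ∷ c ∷ []))
    second : + 2 * (a′ * R) * (ε * (x₂ * a′ - c * b)) + + 2 * b * (ε * (c * a′ * R - S * x₂ * b)) ≡ x₁ * + 0 + x₂ * + 2
    second = by-combination ((+ 2 * ε * x₂) · reduced-norm ⊕ (+ 2 * x₂) · εε≡1)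
      (solve (R ∷ S ∷ a′ ∷ b ∷ ε ∷ x₁ ∷ x₂ ∷ c ∷ []))

  R∤2 : ¬ (R ∣ + 2)
  R∤2 (divides c 2≡cR) = ¬0≤-1 (by-nonNeg (+-mono-≤ (0≤-* 1≤c 0≤R) 3≤R) (by-combination (1ℤ · 2≡cR) (solve (R ∷ c ∷ []))))
    where
    1≤c : 0ℤ ≤ c - 1ℤ
    1≤c = 1≤-factor R c 1≤R (by-nonNeg (0≤+ 1) (by-combination (-1ℤ · 2≡cR) (solve (R ∷ c ∷ []))))

  γ-prime : IsPrimePrincipal (R * S) γ
  γ-prime = (λ one∈γ → R∤2 (proj₂ (principal⇒lattice one one∈γ))) , product
    where
    product : ∀ α β → InOK α → InOK β → Σ Elt (λ δ → InOK δ × (prod4 (R * S) γ δ ≡ prod4 (R * S) α β)) →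
              InPrincipal (R * S) γ α ⊎ InPrincipal (R * S) γ β
    product (α₁ , α₂) (β₁ , β₂) α∈O β∈O ((δ₁ , δ₂) , _ , γδ≡αβ) =
      Sum.map (λ R∣α₁ → lattice⇒principal (α₁ , α₂) (α∈O , R∣α₁)) (λ R∣β₁ → lattice⇒principal (β₁ , β₂) (β∈O , R∣β₁))
        (euclid-R α₁ β₁ (divides (+ 2 * a′ * δ₁ + + 2 * S * b * δ₂ - S * (α₂ * β₂))
          (by-combination (-1ℤ · first) (solve (R ∷ S ∷ a′ ∷ b ∷ δ₁ ∷ δ₂ ∷ α₁ ∷ α₂ ∷ β₁ ∷ β₂ ∷ [])))))
      where
      first : + 2 * (a′ * R) * δ₁ + R * S * (+ 2 * b * δ₂) ≡ α₁ * β₁ + R * S * (α₂ * β₂)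
      first = cong proj₁ γδ≡αβ

  α₀ β₀ : Elt
  α₀ = R , 1ℤ
  β₀ = R , -1ℤ

  α₀∈γ : InPrincipal (R * S) γ α₀
  α₀∈γ = lattice⇒principal α₀
    (∣⇒∣ᵤ {+ 2} {R - 1ℤ} (divides K (by-combination (1ℤ · R≡2K+1) (solve (R ∷ K ∷ [])))) , divides 1ℤ (sym (*-identityˡ R)))

  β₀∈γ : InPrincipal (R * S) γ β₀
  β₀∈γ = lattice⇒principal β₀
    (∣⇒∣ᵤ {+ 2} {R - -1ℤ} (divides (K + 1ℤ) (by-combination (1ℤ · R≡2K+1) (solve (R ∷ K ∷ [])))) , divides 1ℤ (sym (*-identityˡ R)))

  α₀,β₀-independent : Independent α₀ β₀
  α₀,β₀-independent det≡0 = ¬0≤-1 (by-nonNeg (+-mono-≤ (0≤-* (0≤+ 2) 3≤R) (0≤+ 5))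
    (by-combination (1ℤ · i-j≡0⇒i≡j (R * -1ℤ) (1ℤ * R) det≡0) (solve (R ∷ []))))

  α₀-minimal : ∀ δ → InPrincipal (R * S) γ δ → (IsZero δ → ⊥) → sqLen2 (R * S) α₀ ≤ sqLen2 (R * S) δ
  α₀-minimal (x₁ , x₂) δ∈γ δ≢0 = from-lattice (principal⇒lattice (x₁ , x₂) δ∈γ)
    where
    from-lattice : Lattice (x₁ , x₂) → R * R + R * S * (1ℤ * 1ℤ) ≤ x₁ * x₁ + R * S * (x₂ * x₂)
    from-lattice (x∈O , divides c x₁≡cR) = 0≤i-j⇒j≤i {x₁ * x₁ + R * S * (x₂ * x₂)} {R * R + R * S * (1ℤ * 1ℤ)}
      (subst (λ z → 0ℤ ≤ z * z + R * S * (x₂ * x₂) - (R * R + R * S * (1ℤ * 1ℤ))) (sym x₁≡cR)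
        (odd-lattice-minimum {R} {S} {K} R≡2K+1 1≤R 1≤S R≤3S S≤3R c x₂ (subst (λ z → + 2 ∣ z - x₂) x₁≡cR (∣ᵤ⇒∣ x∈O))
          (λ (cR≡0 , x₂≡0) → δ≢0 (cong₂ _,_ (trans x₁≡cR cR≡0) x₂≡0))))

  prime-PWR : HasPrimePWR (R * S)
  prime-PWR = γ , ∣⇒∣ᵤ {+ 2} {+ 2 * (a′ * R) - + 2 * b} (divides (a′ * R - b) (solve (R ∷ a′ ∷ b ∷ []))) , γ-prime ,
    (α₀ , β₀ , α₀∈γ , β₀∈γ , (λ α₀≡0 → 1≢0 (cong proj₂ α₀≡0)) , (λ β₀≡0 → -1≢0 (cong proj₂ β₀≡0)) ,
     α₀,β₀-independent , refl , α₀-minimal)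
    where
    1≢0 : 1ℤ ≢ 0ℤ
    1≢0 ()
    -1≢0 : -1ℤ ≢ 0ℤ
    -1≢0 ()

product-of-4k+3 : ∀ {P Q k l} → P ≡ + 4 * k + + 3 → Q ≡ + 4 * l + + 3 →
  P * Q ≡ + 4 * (+ 4 * k * l + + 3 * k + + 3 * l + + 2) + 1ℤ
product-of-4k+3 {P} {Q} {k} {l} P≡4k+3 Q≡4l+3 =
  by-combination (Q · P≡4k+3 ⊕ (+ 4 * k + + 3) · Q≡4l+3) (solve (P ∷ Q ∷ k ∷ l ∷ []))

1≤-* : ∀ {P Q} → 0ℤ ≤ P - 1ℤ → 0ℤ ≤ Q - 1ℤ → 0ℤ ≤ P * Q - 1ℤ
1≤-* {P} {Q} 1≤P 1≤Q = by-nonNeg (+-mono-≤ (+-mono-≤ (0≤-* 1≤P 1≤Q) 1≤P) 1≤Q) (solve (P ∷ Q ∷ []))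

prime⇒1≤ : ∀ {p} → Prime p → 0ℤ ≤ + p - 1ℤ
prime⇒1≤ {zero} p-prime = ⊥-elim (¬prime[0] p-prime)
prime⇒1≤ {suc p-1} _ = 0≤+ p-1

negative-unit⇒∣ : ∀ {P Q x y} → x * x - P * Q * (y * y) ≡ -1ℤ → P ∣ x * x + 1ℤ
negative-unit⇒∣ {P} {Q} {x} {y} N≡-1 = divides (Q * (y * y)) (by-combination (1ℤ · N≡-1) (solve (P ∷ Q ∷ x ∷ y ∷ [])))

NormElement : ℤ → ℤ → Set
NormElement d n = Σ ℤ λ a → Σ ℤ λ b → a * a - d * (b * b) ≡± n

element-of-norm-±p-or-±q : ∀ {p q} → Prime p → Prime q → p ≢ q → p ℕ.% 4 ≡ 3 → q ℕ.% 4 ≡ 3 →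
  NormElement (+ p * + q) (+ p) ⊎ NormElement (+ p * + q) (+ q)
element-of-norm-±p-or-±q {p} {q} p-prime q-prime p≢q p%4≡3 q%4≡3 =
  from-divisor (descent (from-pell (pell-equation (p ℕ.* q) (prime-product≢square p-prime q-prime p≢q))))
  where
  k = + (p ℕ./ 4)
  l = + (q ℕ./ 4)
  open Descent (+ p * + q) (+ 4 * k * l + + 3 * k + + 3 * l + + 2)
    (product-of-4k+3 {+ p} {+ q} {k} {l} (≡4k+3 p p%4≡3) (≡4k+3 q q%4≡3))
    (1≤-* {+ p} {+ q} (prime⇒1≤ p-prime) (prime⇒1≤ q-prime))
    (λ a → pq∣square⇒pq∣ a p-prime q-prime p≢q)
    (λ x y N≡-1 → -1-nonresidue p-prime p%4≡3 x (negative-unit⇒∣ {+ p} {+ q} {x} {y} N≡-1))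
  from-pell : NontrivialUnit (+ (p ℕ.* q)) → Solution
  from-pell (x , y , y≢0 , N≡±1) =
    solution x y y≢0 (unit-norm x y (subst (λ d → x * x - d * (y * y) ≡± 1ℤ) (pos-* p q) N≡±1))
  from-divisor : ProperDivisorNorm → NormElement (+ p * + q) (+ p) ⊎ NormElement (+ p * + q) (+ q)
  from-divisor (element a b n∣pq n≢±1 n≢±pq) =
    [ ⊥-elim ∘′ n≢±1 , [ inj₁ ∘′ (λ n≡±p → a , b , n≡±p) , [ inj₂ ∘′ (λ n≡±q → a , b , n≡±q) , ⊥-elim ∘′ n≢±pq ]′ ]′ ]′
      (divisors-of-pq p-prime q-prime n∣pq)

prime-PWR-from-norm : ∀ {R S k l} → R ≡ + 4 * k + + 3 → S ≡ + 4 * l + + 3 → 0ℤ ≤ k → 0ℤ ≤ l →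
  (∀ m n → R ∣ m * n → (R ∣ m) ⊎ (R ∣ n)) → 0ℤ ≤ + 3 * S - R → 0ℤ ≤ + 3 * R - S →
  NormElement (R * S) R → HasPrimePWR (R * S)
prime-PWR-from-norm {R} {S} {k} {l} R≡4k+3 S≡4l+3 0≤k 0≤l euclid-R R≤3S S≤3R (a , b , N≡±R) =
  from-unit (≡±-as-unit N≡±R)
  where
  from-unit : (Σ ℤ λ ε → ε ≡± 1ℤ × a * a - R * S * (b * b) ≡ ε * R) → HasPrimePWR (R * S)
  from-unit (ε , ε≡±1 , N≡εR) = from-multiple (Sum.reduce (euclid-R a a R∣a²))
    where
    R∣a² : R ∣ a * a
    R∣a² = divides (S * (b * b) + ε) (by-combination (1ℤ · N≡εR) (solve (R ∷ S ∷ a ∷ b ∷ ε ∷ [])))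
    1≤R : 0ℤ ≤ R - 1ℤ
    1≤R = by-nonNeg (+-mono-≤ (0≤-* (0≤+ 4) 0≤k) (0≤+ 2)) (by-combination (1ℤ · R≡4k+3) (solve (R ∷ k ∷ [])))
    from-multiple : R ∣ a → HasPrimePWR (R * S)
    from-multiple (divides a′ a≡a′R) = PrimeIdeal.prime-PWR R S (+ 2 * k + 1ℤ) (+ 2 * l + 1ℤ) a′ b ε
      (by-combination (1ℤ · R≡4k+3) (solve (R ∷ k ∷ [])))
      (by-combination (1ℤ · S≡4l+3) (solve (S ∷ l ∷ [])))
      (by-nonNeg (0≤-* (0≤+ 4) 0≤k) (by-combination (1ℤ · R≡4k+3) (solve (R ∷ k ∷ []))))
      (by-nonNeg (+-mono-≤ (0≤-* (0≤+ 4) 0≤l) (0≤+ 2)) (by-combination (1ℤ · S≡4l+3) (solve (S ∷ l ∷ []))))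
      R≤3S S≤3R euclid-R ε≡±1
      (*-cancelˡ-pos {R} (R * (a′ * a′) - S * (b * b)) ε 1≤R
        (by-combination (1ℤ · N≡εR ⊕ (- (a + a′ * R)) · a≡a′R) (solve (R ∷ S ∷ a ∷ b ∷ ε ∷ a′ ∷ []))))

ℕ≤3*⇒0≤ : ∀ {m n} → m ℕ.≤ 3 ℕ.* n → 0ℤ ≤ + 3 * + n - + m
ℕ≤3*⇒0≤ {m} {n} m≤3n = subst (λ k → 0ℤ ≤ k - + m) (pos-* 3 n) (0≤-of-ℕ≤ m≤3n)

prime-PWR : ∀ {r s} → Prime r → r ℕ.% 4 ≡ 3 → s ℕ.% 4 ≡ 3 → r ℕ.≤ 3 ℕ.* s → s ℕ.≤ 3 ℕ.* r →
  NormElement (+ r * + s) (+ r) → HasPrimePWR (+ r * + s)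
prime-PWR {r} {s} r-prime r%4≡3 s%4≡3 r≤3s s≤3r =
  prime-PWR-from-norm {+ r} {+ s} {+ (r ℕ./ 4)} {+ (s ℕ./ 4)}
    (≡4k+3 r r%4≡3) (≡4k+3 s s%4≡3) (0≤+ (r ℕ./ 4)) (0≤+ (s ℕ./ 4))
    (λ m n → euclid m n r-prime) (ℕ≤3*⇒0≤ {r} {s} r≤3s) (ℕ≤3*⇒0≤ {s} {r} s≤3r)

corollary7p5 : (p q : ℕ) → Prime p → Prime q → p ℕ.< q → q ℕ.< 3 ℕ.* p →
    p ℕ.% 4 ≡ 3 → q ℕ.% 4 ≡ 3 → HasPrimePWR (+ (p ℕ.* q))
corollary7p5 p q p-prime q-prime p<q q<3p p%4≡3 q%4≡3 =
  subst HasPrimePWR (sym (pos-* p q))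
    ([ prime-PWR p-prime p%4≡3 q%4≡3 p≤3q q≤3p , norm-±q⇒PWR ]′
      (element-of-norm-±p-or-±q p-prime q-prime (ℕₚ.<⇒≢ p<q) p%4≡3 q%4≡3))
  where
  p≤3q : p ℕ.≤ 3 ℕ.* q
  p≤3q = ℕₚ.≤-trans (ℕₚ.<⇒≤ p<q) (ℕₚ.m≤n*m q 3)
  q≤3p : q ℕ.≤ 3 ℕ.* p
  q≤3p = ℕₚ.<⇒≤ q<3p
  norm-±q⇒PWR : NormElement (+ p * + q) (+ q) → HasPrimePWR (+ p * + q)
  norm-±q⇒PWR = subst HasPrimePWR (*-comm (+ q) (+ p))
    ∘′ prime-PWR q-prime q%4≡3 p%4≡3 q≤3p p≤3q
    ∘′ subst (λ d → NormElement d (+ q)) (*-comm (+ p) (+ q))
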